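{- Let $f:\mathbb{N}\to\mathbb{C}$ be an arbitrary arithmetic function, and for $n\in\mathbb{N}$ define $G_f(n)=\sum_{ab=n} f(\gcd(a,b))$ and $L_f(n)=\sum_{ab=n} f(\operatorname{lcm}(a,b))$, the sums over ordered pairs of positive integers $(a,b)$ with $ab=n$. Then for every $n\in\mathbb{N}$, \[ G_f(n)=\sum_{a^2b^2c=n} f(a)\mu(b)\tau(c) = \sum_{a^2c=n} (f*\mu)(a)\,\tau(c) = \sum_{a^2c=n} f(a)\,2^{\omega(c)}, \] and \[ L_f(n)=\sum_{a^2b^2c=n} f(n/a)\mu(b)\tau(c) = \sum_{a^2c=n} f(ac)\,2^{\omega(c)}. \] If $f$ is additive, then for every $n\in\mathbb{N}$, $L_f(n) = 2(f*\mathbf{1})(n) - G_f(n)$. If $f$ is completely additive, then for every $n\in\mathbb{N}$, $L_f(n)=f(n)\tau(n)-G_f(n)$.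
   Context: Sums like $\sum_{a^2b^2c=n}$ run over triples of positive integers satisfying the equation. $\mu$ is the Möbius function, $\tau(n)$ the number of divisors of $n$, $\omega(n)$ the number of distinct prime divisors of $n$, $\mathbf{1}(n)=1$ for all $n$, and $*$ denotes Dirichlet convolution $(g*h)(n)=\sum_{d\mid n} g(d)h(n/d)$. $f$ is additive if $f(mn)=f(m)+f(n)$ whenever $\gcd(m,n)=1$, and completely additive if this holds for all $m,n$. -}

module Defs where

open import Level using (Level)
open import Data.Nat using (ℕ; zero; suc; _≟_; _≤_; _≤?_; _^_)
open import Data.Nat using () renaming (_*_ to _*ℕ_)
open import Data.Nat.DivMod using (_/_)
open import Data.Nat.GCD using (gcd)
open import Data.Nat.LCM using (lcm)
open import Data.Nat.Coprimality using (Coprime)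
open import Data.Nat.Divisibility using (_∣_; _∣?_)
open import Data.Nat.Primality using (Prime; prime?)
open import Data.List using (List; map; upTo; foldr; filter; length)
open import Data.Bool using (if_then_else_)
open import Relation.Nullary.Decidable using (⌊_⌋; _×-dec_)
open import Algebra.Bundles using (CommutativeRing)

rng : ℕ → List ℕ
rng n = map suc (upTo n)

-- truncated division, only ever used with a positive divisor d ∣ n
_div_ : ℕ → ℕ → ℕ
n div zero    = zero
n div (suc k) = n / suc k

τ : ℕ → ℕ
τ n = length (filter (λ d → d ∣? n) (rng n))

ω : ℕ → ℕ
ω n = length (filter (λ p → prime? p ×-dec (p ∣? n)) (rng n))

-- number of d ≥ 2 with d² ∣ n  (n is squarefree iff this is 0)
sqDivCount : ℕ → ℕ
sqDivCount n = length (filter (λ d → (2 ≤? d) ×-dec ((d *ℕ d) ∣? n)) (rng n))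

module Arith {c ℓ : Level} (R : CommutativeRing c ℓ) where
  open CommutativeRing R public

  sumR : List ℕ → (ℕ → Carrier) → Carrier
  sumR xs g = foldr (λ x acc → g x + acc) 0# xs

  _·_ : ℕ → Carrier → Carrier
  zero  · x = 0#
  suc k · x = x + (k · x)

  nat : ℕ → Carrier
  nat k = k · 1#

  neg1^ : ℕ → Carrier
  neg1^ zero    = 1#
  neg1^ (suc k) = (- 1#) * neg1^ k

  μ : ℕ → Carrier
  μ n with sqDivCount n
  ... | zero  = neg1^ (ω n)
  ... | suc _ = 0#

  𝟙 : ℕ → Carrier
  𝟙 _ = 1#

  conv : (ℕ → Carrier) → (ℕ → Carrier) → ℕ → Carrier
  conv g h n = sumR (rng n) (λ d →
    if ⌊ d ∣? n ⌋ then g d * h (n div d) else 0#)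

  sum2 : ℕ → (ℕ → ℕ → Carrier) → Carrier
  sum2 n g = sumR (rng n) (λ a → sumR (rng n) (λ b →
    if ⌊ a *ℕ b ≟ n ⌋ then g a b else 0#))

  sumSq : ℕ → (ℕ → ℕ → Carrier) → Carrier
  sumSq n g = sumR (rng n) (λ a → sumR (rng n) (λ c →
    if ⌊ a *ℕ a *ℕ c ≟ n ⌋ then g a c else 0#))

  sum3 : ℕ → (ℕ → ℕ → ℕ → Carrier) → Carrier
  sum3 n g = sumR (rng n) (λ a → sumR (rng n) (λ b → sumR (rng n) (λ c →
    if ⌊ a *ℕ a *ℕ b *ℕ b *ℕ c ≟ n ⌋ then g a b c else 0#)))

  G : (ℕ → Carrier) → ℕ → Carrier
  G f n = sum2 n (λ a b → f (gcd a b))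

  L : (ℕ → Carrier) → ℕ → Carrier
  L f n = sum2 n (λ a b → f (lcm a b))

  Additive : (ℕ → Carrier) → Set ℓ
  Additive f = ∀ m n → 1 ≤ m → 1 ≤ n → Coprime m n → f (m *ℕ n) ≈ f m + f n

  CompletelyAdditive : (ℕ → Carrier) → Set ℓ
  CompletelyAdditive f = ∀ m n → 1 ≤ m → 1 ≤ n → f (m *ℕ n) ≈ f m + f n

-- Writing x = d u and y = d v with d = gcd x y and u, v coprime turns G_f(n) into
-- Σ_{d² m = n} f(d) C(m), where C(m) counts the ordered coprime factorisations m = u v.
-- Möbius inversion of the coprimality condition gives C(m) = Σ_{b² c = m} μ(b) τ(c), which
-- yields the first two expressions for G_f, and removing one prime at a time from m shows
-- C(m) = 2^ω(m). Since lcm a b = n / gcd a b when a b = n, L_f is G_g for g(d) = f(n/d), and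
-- f(n/a) = f(a c) when a² c = n. For additive f, comparing p-parts gives
-- f(lcm a b) + f(gcd a b) = f(a) + f(b); for completely additive f this sum is f(a b) = f(n).

module Submission where

open import Defs
open import Level using (Level)
open import Algebra.Bundles using (CommutativeRing; CommutativeMonoid)
open import Data.Bool using (if_then_else_)
open import Data.Empty using (⊥; ⊥-elim)
open import Data.List using ([]; _∷_; _++_; _∷ʳ_; map; upTo; foldr; filter; length)
import Data.List.Properties as List
open import Data.List.Relation.Unary.All using (_∷_)
open import Data.Nat using (ℕ; zero; suc; _≤_; _<_; _^_; z≤n; s≤s; _≟_; _≤?_; >-nonZero; nonTrivial⇒n>1)
  renaming (_*_ to _*ℕ_; _+_ to _+ℕ_)
import Data.Nat.Properties as ℕ
open import Data.Nat.Divisibility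
open import Data.Nat.DivMod using (m*n/n≡m)
open import Data.Nat.Induction using (<-rec)
open import Data.Nat.GCD using (gcd; gcd[m,n]∣m; gcd[m,n]∣n; gcd-greatest; gcd-comm; gcd-zeroˡ; gcd[m,n]≡0⇒m≡0; c*gcd[m,n]≡gcd[cm,cn])
open import Data.Nat.LCM using (lcm; gcd*lcm; lcm-comm)
open import Data.Nat.Coprimality as Coprime using (Coprime; coprime?; coprime-divisor; coprime⇒gcd≡1; gcd≡1⇒coprime)
open import Data.Nat.Primality using (Prime; prime?; euclidsLemma; prime⇒irreducible; prime⇒nonTrivial)
open import Data.Nat.Primality.Factorisation using (factorise)
open import Data.Nat.ListAction using (product)
open import Data.Nat.Tactic.RingSolver using (solve-∀)
open import Data.Product using (_×_; _,_; proj₁; proj₂; ∃; ∃₂)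
open import Data.Sum using (_⊎_; inj₁; inj₂; [_,_])
open import Relation.Nullary using (Dec; yes; no; ¬_)
open import Relation.Nullary.Decidable using (⌊_⌋; ¬?; _×-dec_)
open import Relation.Unary using (Pred; Decidable)
open import Relation.Binary.PropositionalEquality as ≡ using (_≡_; _≢_)

*-pos : ∀ {m n} → 1 ≤ m → 1 ≤ n → 1 ≤ m *ℕ n
*-pos {suc _} {suc _} _ _ = s≤s z≤n

m≤m*n⁺ : ∀ m {n} → 1 ≤ n → m ≤ m *ℕ n
m≤m*n⁺ m {suc n} _ = ℕ.m≤m*n m (suc n)

m≤n*m⁺ : ∀ m {n} → 1 ≤ n → m ≤ n *ℕ m
m≤n*m⁺ m {suc n} _ = ℕ.m≤n*m m (suc n)

m≤m*m*n⁺ : ∀ m {n} → 1 ≤ n → m ≤ m *ℕ m *ℕ n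
m≤m*m*n⁺ zero    _   = z≤n
m≤m*m*n⁺ (suc m) 1≤n = ℕ.≤-trans (m≤m*n⁺ (suc m) (s≤s z≤n)) (m≤m*n⁺ (suc m *ℕ suc m) 1≤n)

factor-≤ˡ : ∀ {u v m N} → 1 ≤ v → u *ℕ v ≡ m → m ≤ N → u ≤ N
factor-≤ˡ {u} 1≤v uv≡m m≤N = ℕ.≤-trans (m≤m*n⁺ u 1≤v) (ℕ.≤-trans (ℕ.≤-reflexive uv≡m) m≤N)

factor-≤ʳ : ∀ {u v m N} → 1 ≤ u → u *ℕ v ≡ m → m ≤ N → v ≤ N
factor-≤ʳ {u} {v} 1≤u uv≡m m≤N = ℕ.≤-trans (m≤n*m⁺ v 1≤u) (ℕ.≤-trans (ℕ.≤-reflexive uv≡m) m≤N)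

^-pos : ∀ {p} k → 1 ≤ p → 1 ≤ p ^ k
^-pos zero    _   = s≤s z≤n
^-pos (suc k) 1≤p = *-pos 1≤p (^-pos k 1≤p)

≡*⇒pos : ∀ {m} q {k} → 1 ≤ m → m ≡ q *ℕ k → 1 ≤ q
≡*⇒pos zero    1≤m eq = ⊥-elim (ℕ.<⇒≢ 1≤m (≡.sym eq))
≡*⇒pos (suc _) _   _  = s≤s z≤n

∣⇒≤⁺ : ∀ {d n} → 1 ≤ n → d ∣ n → d ≤ n
∣⇒≤⁺ 1≤n = ∣⇒≤ {{>-nonZero 1≤n}}

*-cancelˡ-≡⁺ : ∀ {p} a b → 1 ≤ p → p *ℕ a ≡ p *ℕ b → a ≡ b
*-cancelˡ-≡⁺ {suc p} a b _ = ℕ.*-cancelˡ-≡ a b (suc p)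

gcd-pos : ∀ u v → 1 ≤ u → 1 ≤ gcd u v
gcd-pos u v 1≤u = ℕ.n≢0⇒n>0 (λ eq → ℕ.<⇒≢ 1≤u (≡.sym (gcd[m,n]≡0⇒m≡0 eq)))

lcm-pos : ∀ x y → 1 ≤ x → 1 ≤ y → 1 ≤ lcm x y
lcm-pos x y 1≤x 1≤y = ℕ.n≢0⇒n>0 λ eq → ℕ.<⇒≢ (*-pos 1≤x 1≤y) (≡.sym (begin
  x *ℕ y             ≡⟨ ≡.sym (gcd*lcm x y) ⟩
  gcd x y *ℕ lcm x y ≡⟨ ≡.cong (gcd x y *ℕ_) eq ⟩
  gcd x y *ℕ 0       ≡⟨ ℕ.*-zeroʳ (gcd x y) ⟩
  0                  ∎))
  where open ≡.≡-Reasoning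

div-≡ : ∀ {m} q k → 1 ≤ k → m ≡ q *ℕ k → m div k ≡ q
div-≡ q (suc k) _ ≡.refl = m*n/n≡m q (suc k)

-- Primes, p-adic valuations and gcd

prime≥2 : ∀ {p} → Prime p → 2 ≤ p
prime≥2 {p} pp = nonTrivial⇒n>1 p {{prime⇒nonTrivial pp}}

prime-pos : ∀ {p} → Prime p → 1 ≤ p
prime-pos pp = ℕ.≤-trans (s≤s z≤n) (prime≥2 pp)

prime∣prime⇒≡ : ∀ {q p} → Prime q → Prime p → q ∣ p → q ≡ p
prime∣prime⇒≡ pq pp q∣p =
  [ (λ q≡1 → ⊥-elim (ℕ.<⇒≢ (prime≥2 pq) (≡.sym q≡1))) , (λ q≡p → q≡p) ] (prime⇒irreducible pp q∣p)

prime∤⇒coprime : ∀ {p v} → Prime p → ¬ p ∣ v → Coprime p v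
prime∤⇒coprime pp p∤v (d∣p , d∣v) =
  [ (λ d≡1 → d≡1) , (λ d≡p → ⊥-elim (p∤v (≡.subst (_∣ _) d≡p d∣v))) ] (prime⇒irreducible pp d∣p)

coprime-*ˡ : ∀ {a b m} → Coprime a m → Coprime b m → Coprime (a *ℕ b) m
coprime-*ˡ {a} {b} {m} a⊥m b⊥m {d} (d∣ab , d∣m) = b⊥m (coprime-divisor d⊥a d∣ab , d∣m)
  where
  d⊥a : Coprime d a
  d⊥a (k∣d , k∣a) = a⊥m (k∣a , ∣-trans k∣d d∣m)

^-coprime : ∀ {p m} → Prime p → ¬ p ∣ m → ∀ k → Coprime (p ^ k) m
^-coprime pp p∤m zero    = Coprime.1-coprimeTo _
^-coprime pp p∤m (suc k) = coprime-*ˡ (prime∤⇒coprime pp p∤m) (^-coprime pp p∤m k)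

coprime-p*⇒ : ∀ {p u v} → Prime p → Coprime (p *ℕ u) v → Coprime u v × ¬ p ∣ v
coprime-p*⇒ {p} {u} pp pu⊥v =
  (λ (d∣u , d∣v) → pu⊥v (∣n⇒∣m*n p d∣u , d∣v)) ,
  (λ p∣v → ℕ.<⇒≢ (prime≥2 pp) (≡.sym (pu⊥v (m∣m*n u , p∣v))))

coprime-p*⇐ : ∀ {p u v} → Prime p → Coprime u v → ¬ p ∣ v → Coprime (p *ℕ u) v
coprime-p*⇐ pp u⊥v p∤v = coprime-*ˡ (prime∤⇒coprime pp p∤v) u⊥v

prime-divisor : ∀ g → 2 ≤ g → ∃ λ p → Prime p × p ∣ g
prime-divisor g 2≤g with factorise g {{>-nonZero (ℕ.≤-trans (s≤s z≤n) 2≤g)}}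
... | record { factors = [] ; isFactorisation = eq } = ⊥-elim (ℕ.<⇒≢ 2≤g (≡.sym eq))
... | record { factors = p ∷ ps ; isFactorisation = eq ; factorsPrime = pp ∷ _ } =
  p , pp , divides (product ps) (≡.trans eq (ℕ.*-comm p (product ps)))

p-adic-split : ∀ {p x} → Prime p → 1 ≤ x → ∃₂ λ a x′ → x ≡ p ^ a *ℕ x′ × ¬ p ∣ x′
p-adic-split {p} {x} pp = split x ℕ.≤-refl
  where
  split : ∀ {x} k → x ≤ k → 1 ≤ x → ∃₂ λ a x′ → x ≡ p ^ a *ℕ x′ × ¬ p ∣ x′
  split {x} k x≤k 1≤x with p ∣? x
  ... | no p∤x = 0 , x , ≡.sym (ℕ.+-identityʳ x) , p∤x
  split {x} zero x≤k 1≤x | yes _ = ⊥-elim (ℕ.<⇒≱ 1≤x x≤k)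
  split {x} (suc k) x≤k 1≤x | yes (divides q x≡q*p)
    with split k (ℕ.≤-pred (ℕ.≤-trans (ℕ.<-≤-trans q<q*p (ℕ.≤-reflexive (≡.sym x≡q*p))) x≤k)) 1≤q
    where
    1≤q = ≡*⇒pos q 1≤x x≡q*p
    q<q*p = ℕ.m<m*n q p {{>-nonZero 1≤q}} (prime≥2 pp)
  ... | a , x′ , q≡ , p∤x′ = suc a , x′ , ≡.trans x≡q*p (≡.trans (≡.cong (_*ℕ p) q≡) (rearrange (p ^ a) x′ p)) , p∤x′
    where
    rearrange : ∀ m x p → m *ℕ x *ℕ p ≡ p *ℕ m *ℕ x
    rearrange = solve-∀

p-adic-cofactor-< : ∀ {p a x x′} → Prime p → p ∣ x → 1 ≤ x → x ≡ p ^ a *ℕ x′ → ¬ p ∣ x′ → x′ < x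
p-adic-cofactor-< {p} {zero} {x} {x′} _ p∣x _ x≡ p∤x′ = ⊥-elim (p∤x′ (≡.subst (p ∣_) (≡.trans x≡ (ℕ.+-identityʳ x′)) p∣x))
p-adic-cofactor-< {p} {suc a} {x} {x′} pp _ 1≤x x≡ _ =
  ℕ.<-≤-trans (ℕ.m<m*n x′ (p ^ suc a) {{>-nonZero 1≤x′}} (ℕ.≤-trans (prime≥2 pp) (m≤m*n⁺ p (^-pos a (prime-pos pp)))))
            (ℕ.≤-reflexive (≡.trans (ℕ.*-comm x′ (p ^ suc a)) (≡.sym x≡)))
  where 1≤x′ = ≡*⇒pos x′ 1≤x (≡.trans x≡ (ℕ.*-comm (p ^ suc a) x′))

gcd-*-coprime : ∀ x y c → Coprime c x → gcd x (c *ℕ y) ≡ gcd x y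
gcd-*-coprime x y c c⊥x = ∣-antisym
  (gcd-greatest (gcd[m,n]∣m x (c *ℕ y)) (coprime-divisor g⊥c (gcd[m,n]∣n x (c *ℕ y))))
  (gcd-greatest (gcd[m,n]∣m x y) (∣n⇒∣m*n c (gcd[m,n]∣n x y)))
  where
  g⊥c : Coprime (gcd x (c *ℕ y)) c
  g⊥c (k∣g , k∣c) = c⊥x (k∣c , ∣-trans k∣g (gcd[m,n]∣m x (c *ℕ y)))

lcm-unique : ∀ x y l → 1 ≤ x → gcd x y *ℕ l ≡ x *ℕ y → lcm x y ≡ l
lcm-unique x y l 1≤x eq =
  ℕ.*-cancelˡ-≡ (lcm x y) l (gcd x y) {{>-nonZero (gcd-pos x y 1≤x)}} (≡.trans (gcd*lcm x y) (≡.sym eq))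

gcd-lcm-p-adic : ∀ {p a b x y} → Prime p → a ≤ b → 1 ≤ x → ¬ p ∣ x →
                 gcd (p ^ a *ℕ x) (p ^ b *ℕ y) ≡ p ^ a *ℕ gcd x y × lcm (p ^ a *ℕ x) (p ^ b *ℕ y) ≡ p ^ b *ℕ lcm x y
gcd-lcm-p-adic {p} {a} {b} {x} {y} pp a≤b 1≤x p∤x with ℕ.m≤n⇒∃[o]m+o≡n a≤b
... | c , ≡.refl = gcd≡ , lcm-unique _ _ _ (*-pos (^-pos a (prime-pos pp)) 1≤x) (begin
    gcd (p ^ a *ℕ x) (p ^ (a +ℕ c) *ℕ y) *ℕ (p ^ (a +ℕ c) *ℕ lcm x y) ≡⟨ ≡.cong₂ _*ℕ_ gcd≡ (≡.cong (_*ℕ lcm x y) (ℕ.^-distribˡ-+-* p a c)) ⟩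
    p ^ a *ℕ gcd x y *ℕ (p ^ a *ℕ p ^ c *ℕ lcm x y)                     ≡⟨ regroup (p ^ a) (p ^ c) (gcd x y) (lcm x y) ⟩
    p ^ a *ℕ (p ^ a *ℕ p ^ c) *ℕ (gcd x y *ℕ lcm x y)                   ≡⟨ ≡.cong (p ^ a *ℕ (p ^ a *ℕ p ^ c) *ℕ_) (gcd*lcm x y) ⟩
    p ^ a *ℕ (p ^ a *ℕ p ^ c) *ℕ (x *ℕ y)                               ≡⟨ regroup′ (p ^ a) (p ^ c) x y ⟩
    p ^ a *ℕ x *ℕ (p ^ a *ℕ p ^ c *ℕ y)                                 ≡⟨ ≡.cong (λ q → p ^ a *ℕ x *ℕ (q *ℕ y)) (ℕ.^-distribˡ-+-* p a c) ⟨
    p ^ a *ℕ x *ℕ (p ^ (a +ℕ c) *ℕ y)                                   ∎)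
  where
  open ≡.≡-Reasoning
  regroup : ∀ A C g l → A *ℕ g *ℕ (A *ℕ C *ℕ l) ≡ A *ℕ (A *ℕ C) *ℕ (g *ℕ l)
  regroup = solve-∀
  regroup′ : ∀ A C x y → A *ℕ (A *ℕ C) *ℕ (x *ℕ y) ≡ A *ℕ x *ℕ (A *ℕ C *ℕ y)
  regroup′ = solve-∀
  gcd≡ : gcd (p ^ a *ℕ x) (p ^ (a +ℕ c) *ℕ y) ≡ p ^ a *ℕ gcd x y
  gcd≡ = begin
    gcd (p ^ a *ℕ x) (p ^ (a +ℕ c) *ℕ y)        ≡⟨ ≡.cong (λ q → gcd (p ^ a *ℕ x) (q *ℕ y)) (ℕ.^-distribˡ-+-* p a c) ⟩
    gcd (p ^ a *ℕ x) (p ^ a *ℕ p ^ c *ℕ y)      ≡⟨ ≡.cong (gcd (p ^ a *ℕ x)) (ℕ.*-assoc (p ^ a) (p ^ c) y) ⟩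
    gcd (p ^ a *ℕ x) (p ^ a *ℕ (p ^ c *ℕ y))    ≡⟨ c*gcd[m,n]≡gcd[cm,cn] (p ^ a) x (p ^ c *ℕ y) ⟨
    p ^ a *ℕ gcd x (p ^ c *ℕ y)                 ≡⟨ ≡.cong (p ^ a *ℕ_) (gcd-*-coprime x y (p ^ c) (^-coprime pp p∤x c)) ⟩
    p ^ a *ℕ gcd x y                            ∎

gcd-*-coprime-cofactors : ∀ d {u v} → Coprime u v → gcd (d *ℕ u) (d *ℕ v) ≡ d
gcd-*-coprime-cofactors d {u} {v} u⊥v =
  ≡.trans (≡.sym (c*gcd[m,n]≡gcd[cm,cn] d u v)) (≡.trans (≡.cong (d *ℕ_) (coprime⇒gcd≡1 u⊥v)) (ℕ.*-identityʳ d))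

gcd-cofactors-coprime : ∀ {x y qx qy} → 1 ≤ x → x ≡ qx *ℕ gcd x y → y ≡ qy *ℕ gcd x y → Coprime qx qy
gcd-cofactors-coprime {x} {y} {qx} {qy} 1≤x x≡ y≡ {k} (k∣qx , k∣qy) =
  ∣1⇒≡1 (*-cancelʳ-∣ g {{>-nonZero (gcd-pos x y 1≤x)}} (≡.subst (k *ℕ g ∣_) (≡.sym (ℕ.*-identityˡ g))
    (gcd-greatest (≡.subst (k *ℕ g ∣_) (≡.sym x≡) (*-monoˡ-∣ g k∣qx)) (≡.subst (k *ℕ g ∣_) (≡.sym y≡) (*-monoˡ-∣ g k∣qy)))))
  where g = gcd x y

lcm≡div-gcd : ∀ {a b n} → 1 ≤ a → a *ℕ b ≡ n → lcm a b ≡ n div gcd a b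
lcm≡div-gcd {a} {b} 1≤a ab≡n = ≡.sym (div-≡ (lcm a b) (gcd a b) (gcd-pos a b 1≤a)
  (≡.trans (≡.sym ab≡n) (≡.trans (≡.sym (gcd*lcm a b)) (ℕ.*-comm (gcd a b) (lcm a b)))))

div-square : ∀ {a c n} → 1 ≤ a → a *ℕ a *ℕ c ≡ n → n div a ≡ a *ℕ c
div-square {a} {c} 1≤a aac≡n = div-≡ (a *ℕ c) a 1≤a (≡.trans (≡.sym aac≡n) (rearrange a c))
  where
  rearrange : ∀ a c → a *ℕ a *ℕ c ≡ a *ℕ c *ℕ a
  rearrange = solve-∀

-- Guarded terms and sums over 1, …, N in a commutative monoid

rng-suc : ∀ N → rng (suc N) ≡ rng N ∷ʳ suc N
rng-suc N = ≡.trans (≡.cong (map suc) (≡.sym (List.upTo-∷ʳ N))) (List.map-++ suc (upTo N) (N ∷ []))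

module FiniteSums {c ℓ : Level} (M : CommutativeMonoid c ℓ) where

  open CommutativeMonoid M
    renaming (_∙_ to _+_; ε to 0#; ∙-cong to +-cong; ∙-congˡ to +-congˡ; ∙-congʳ to +-congʳ;
              identityˡ to +-identityˡ; identityʳ to +-identityʳ; assoc to +-assoc)
  open import Algebra.Properties.CommutativeSemigroup commutativeSemigroup using (interchange)
  open import Relation.Binary.Reasoning.Setoid setoid

  infixr 5 ⟦_⟧_

  ⟦_⟧_ : ∀ {p} {A : Set p} → Dec A → Carrier → Carrier
  ⟦ d ⟧ x = if ⌊ d ⌋ then x else 0#

  module _ {p} {A : Set p} where

    ⟦⟧-yes : ∀ (d : Dec A) {x} → A → ⟦ d ⟧ x ≈ x
    ⟦⟧-yes (yes _) _ = refl
    ⟦⟧-yes (no ¬a) a = ⊥-elim (¬a a)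

    ⟦⟧-no : ∀ (d : Dec A) {x} → ¬ A → ⟦ d ⟧ x ≈ 0#
    ⟦⟧-no (yes a) ¬a = ⊥-elim (¬a a)
    ⟦⟧-no (no _)  _  = refl

    ⟦⟧-0 : ∀ (d : Dec A) → ⟦ d ⟧ 0# ≈ 0#
    ⟦⟧-0 (yes _) = refl
    ⟦⟧-0 (no _)  = refl

    ⟦⟧-+ : ∀ (d : Dec A) {x y} → ⟦ d ⟧ (x + y) ≈ (⟦ d ⟧ x) + (⟦ d ⟧ y)
    ⟦⟧-+ (yes _) = refl
    ⟦⟧-+ (no _)  = sym (+-identityʳ 0#)

    ⟦⟧-split : ∀ (d : Dec A) x → x ≈ (⟦ d ⟧ x) + (⟦ ¬? d ⟧ x)
    ⟦⟧-split (yes _) x = sym (+-identityʳ x)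
    ⟦⟧-split (no _)  x = sym (+-identityˡ x)

  module _ {p q} {A : Set p} {B : Set q} where

    ⟦⟧-⇔ : ∀ (d : Dec A) (e : Dec B) {x y} → (A → B) → (B → A) → (A → x ≈ y) → ⟦ d ⟧ x ≈ ⟦ e ⟧ y
    ⟦⟧-⇔ (yes a) e A→B B→A x≈y = trans (x≈y a) (sym (⟦⟧-yes e (A→B a)))
    ⟦⟧-⇔ (no ¬a) e A→B B→A x≈y = sym (⟦⟧-no e (λ b → ¬a (B→A b)))

    ⟦⟧-nest : ∀ (d : Dec A) (e : Dec B) {x} → ⟦ d ⟧ ⟦ e ⟧ x ≈ ⟦ d ×-dec e ⟧ x
    ⟦⟧-nest (yes _) (yes _) = refl
    ⟦⟧-nest (yes _) (no _)  = refl
    ⟦⟧-nest (no _)  _       = refl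

  ⟦⟧-⊎ : ∀ {p q r} {A : Set p} {B : Set q} {C : Set r} (d : Dec A) (e : Dec B) (f : Dec C) {x} →
         (A → B ⊎ C) → (B ⊎ C → A) → (B → C → ⊥) → ⟦ d ⟧ x ≈ (⟦ e ⟧ x) + (⟦ f ⟧ x)
  ⟦⟧-⊎ d (yes b) (yes c) _ _ disjoint = ⊥-elim (disjoint b c)
  ⟦⟧-⊎ d (yes b) (no _)  _ ⇐ _ = trans (⟦⟧-yes d (⇐ (inj₁ b))) (sym (+-identityʳ _))
  ⟦⟧-⊎ d (no _)  (yes c) _ ⇐ _ = trans (⟦⟧-yes d (⇐ (inj₂ c))) (sym (+-identityˡ _))
  ⟦⟧-⊎ d (no ¬b) (no ¬c) ⇒ _ _ = trans (⟦⟧-no d (λ a → [ ¬b , ¬c ] (⇒ a))) (sym (+-identityˡ _))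

  ⟦⟧-cong : ∀ {p} {A : Set p} (d : Dec A) {x y} → (A → x ≈ y) → ⟦ d ⟧ x ≈ ⟦ d ⟧ y
  ⟦⟧-cong d = ⟦⟧-⇔ d d (λ a → a) (λ a → a)

  ⟦⟧-nest-⇔ : ∀ {p q r s} {A : Set p} {B : Set q} {C : Set r} {D : Set s}
              (a : Dec A) (b : Dec B) (c : Dec C) (d : Dec D) {x} →
              (A × B → C × D) → (C × D → A × B) → ⟦ a ⟧ ⟦ b ⟧ x ≈ ⟦ c ⟧ ⟦ d ⟧ x
  ⟦⟧-nest-⇔ a b c d ⇒ ⇐ =
    trans (⟦⟧-nest a b) (trans (⟦⟧-⇔ (a ×-dec b) (c ×-dec d) ⇒ ⇐ (λ _ → refl)) (sym (⟦⟧-nest c d)))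

  ⟦⟧-no₃ : ∀ {p q r} {A : Set p} {B : Set q} {C : Set r} (a : Dec A) (b : Dec B) (c : Dec C) {x} →
           (A → B → C → ⊥) → ⟦ a ⟧ ⟦ b ⟧ ⟦ c ⟧ x ≈ 0#
  ⟦⟧-no₃ (yes a) (yes b) (yes c) never = ⊥-elim (never a b c)
  ⟦⟧-no₃ (yes _) (yes _) (no _)  _     = refl
  ⟦⟧-no₃ (yes _) (no _)  _       _     = refl
  ⟦⟧-no₃ (no _)  _       _       _     = refl

  ⟦≟⟧-cong : ∀ {x y} n {v} → x ≡ y → ⟦ x ≟ n ⟧ v ≈ ⟦ y ≟ n ⟧ v
  ⟦≟⟧-cong n ≡.refl = refl

  ⟦⟧-swap : ∀ {p q} {A : Set p} {B : Set q} (a : Dec A) (b : Dec B) {x} → ⟦ a ⟧ ⟦ b ⟧ x ≈ ⟦ b ⟧ ⟦ a ⟧ x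
  ⟦⟧-swap a b = ⟦⟧-nest-⇔ a b b a (λ (x , y) → y , x) (λ (x , y) → y , x)

  sumTo : ℕ → (ℕ → Carrier) → Carrier
  sumTo zero    g = 0#
  sumTo (suc N) g = sumTo N g + g (suc N)

  infixr 5 sumTo
  syntax sumTo N (λ x → e) = ∑[ x ≤ N ] e

  foldr-rng : ∀ N (g : ℕ → Carrier) → foldr (λ x acc → g x + acc) 0# (rng N) ≈ sumTo N g
  foldr-rng zero    g = refl
  foldr-rng (suc N) g = begin
    foldr step 0# (rng (suc N))            ≡⟨ ≡.cong (foldr step 0#) (rng-suc N) ⟩
    foldr step 0# (rng N ++ suc N ∷ [])    ≡⟨ List.foldr-++ step 0# (rng N) (suc N ∷ []) ⟩
    foldr step (g (suc N) + 0#) (rng N)    ≈⟨ foldr-init (rng N) (+-identityʳ _) ⟩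
    foldr step (g (suc N)) (rng N)         ≈⟨ foldr-+ (rng N) ⟩
    foldr step 0# (rng N) + g (suc N)      ≈⟨ +-congʳ (foldr-rng N g) ⟩
    sumTo N g + g (suc N)                  ∎
    where
    step : ℕ → Carrier → Carrier
    step x acc = g x + acc
    foldr-init : ∀ xs {a b} → a ≈ b → foldr step a xs ≈ foldr step b xs
    foldr-init []       a≈b = a≈b
    foldr-init (x ∷ xs) a≈b = +-congˡ (foldr-init xs a≈b)
    foldr-+ : ∀ xs {a} → foldr step a xs ≈ foldr step 0# xs + a
    foldr-+ []       = sym (+-identityˡ _)
    foldr-+ (x ∷ xs) = trans (+-congˡ (foldr-+ xs)) (sym (+-assoc _ _ _))

  sumTo-cong : ∀ N {g h} → (∀ x → 1 ≤ x → x ≤ N → g x ≈ h x) → sumTo N g ≈ sumTo N h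
  sumTo-cong zero    g≈h = refl
  sumTo-cong (suc N) g≈h =
    +-cong (sumTo-cong N (λ x 1≤x x≤N → g≈h x 1≤x (ℕ.m≤n⇒m≤1+n x≤N))) (g≈h (suc N) (s≤s z≤n) ℕ.≤-refl)

  sumTo-zero : ∀ N {g} → (∀ x → 1 ≤ x → x ≤ N → g x ≈ 0#) → sumTo N g ≈ 0#
  sumTo-zero N g≈0 = trans (sumTo-cong N g≈0) (sumTo-0 N)
    where
    sumTo-0 : ∀ N → ∑[ x ≤ N ] 0# ≈ 0#
    sumTo-0 zero    = refl
    sumTo-0 (suc N) = trans (+-identityʳ _) (sumTo-0 N)

  sumTo-+ : ∀ N (g h : ℕ → Carrier) → ∑[ x ≤ N ] (g x + h x) ≈ sumTo N g + sumTo N h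
  sumTo-+ zero    g h = sym (+-identityʳ 0#)
  sumTo-+ (suc N) g h = begin
    (∑[ x ≤ N ] (g x + h x)) + (g (suc N) + h (suc N)) ≈⟨ +-congʳ (sumTo-+ N g h) ⟩
    (sumTo N g + sumTo N h) + (g (suc N) + h (suc N)) ≈⟨ interchange _ _ _ _ ⟩
    (sumTo N g + g (suc N)) + (sumTo N h + h (suc N)) ∎

  ⟦⟧-sumTo : ∀ {p} {A : Set p} N (d : Dec A) (g : ℕ → Carrier) → ⟦ d ⟧ sumTo N g ≈ ∑[ x ≤ N ] ⟦ d ⟧ g x
  ⟦⟧-sumTo N (yes _) g = refl
  ⟦⟧-sumTo N (no _)  g = sym (sumTo-zero N (λ _ _ _ → refl))

  sumTo-comm : ∀ N M (g : ℕ → ℕ → Carrier) → ∑[ x ≤ N ] ∑[ y ≤ M ] g x y ≈ ∑[ y ≤ M ] ∑[ x ≤ N ] g x y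
  sumTo-comm zero    M g = sym (sumTo-zero M (λ _ _ _ → refl))
  sumTo-comm (suc N) M g = begin
    (∑[ x ≤ N ] ∑[ y ≤ M ] g x y) + (∑[ y ≤ M ] g (suc N) y) ≈⟨ +-congʳ (sumTo-comm N M g) ⟩
    (∑[ y ≤ M ] ∑[ x ≤ N ] g x y) + (∑[ y ≤ M ] g (suc N) y) ≈⟨ sumTo-+ M _ _ ⟨
    ∑[ y ≤ M ] ((∑[ x ≤ N ] g x y) + g (suc N) y)            ∎

  sumTo-single : ∀ N t {g} → 1 ≤ t → t ≤ N → (∀ x → 1 ≤ x → x ≤ N → x ≢ t → g x ≈ 0#) → sumTo N g ≈ g t
  sumTo-single zero    (suc _) _ () _
  sumTo-single (suc N) t {g} 1≤t t≤N others with t ≟ suc N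
  ... | yes ≡.refl = trans (+-congʳ (sumTo-zero N λ x 1≤x x≤N → others x 1≤x (ℕ.m≤n⇒m≤1+n x≤N) (ℕ.<⇒≢ (s≤s x≤N))))
                           (+-identityˡ _)
  ... | no t≢ = trans (+-cong (sumTo-single N t 1≤t (ℕ.≤-pred (ℕ.≤∧≢⇒< t≤N t≢))
                                 (λ x 1≤x x≤N → others x 1≤x (ℕ.m≤n⇒m≤1+n x≤N)))
                              (others (suc N) (s≤s z≤n) ℕ.≤-refl (λ eq → t≢ (≡.sym eq))))
                      (+-identityʳ _)

  sumTo-extend : ∀ N M {g} → N ≤ M → (∀ x → N < x → x ≤ M → g x ≈ 0#) → sumTo M g ≈ sumTo N g
  sumTo-extend N zero    z≤n     _    = refl
  sumTo-extend N (suc M) N≤1+M tail with N ≟ suc M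
  ... | yes ≡.refl = refl
  ... | no N≢ = trans (+-cong (sumTo-extend N M N≤M (λ x N<x x≤M → tail x N<x (ℕ.m≤n⇒m≤1+n x≤M)))
                              (tail (suc M) (s≤s N≤M) ℕ.≤-refl))
                      (+-identityʳ _)
    where N≤M = ℕ.≤-pred (ℕ.≤∧≢⇒< N≤1+M N≢)

  sumTo-≟ : ∀ N t (g : ℕ → Carrier) → 1 ≤ t → (N < t → g t ≈ 0#) → ∑[ x ≤ N ] ⟦ x ≟ t ⟧ g x ≈ g t
  sumTo-≟ N t g 1≤t beyond with t ≤? N
  ... | yes t≤N = trans (sumTo-single N t 1≤t t≤N (λ x _ _ x≢t → ⟦⟧-no (x ≟ t) x≢t)) (⟦⟧-yes (t ≟ t) ≡.refl)
  ... | no  t≰N = trans (sumTo-zero N (λ x _ x≤N → ⟦⟧-no (x ≟ t) (λ { ≡.refl → t≰N x≤N })))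
                        (sym (beyond (ℕ.≰⇒> t≰N)))

  sumTo-*≟ : ∀ N k m (g : ℕ → Carrier) → 1 ≤ k → 1 ≤ m → m ≤ N → ∑[ b ≤ N ] ⟦ k *ℕ b ≟ m ⟧ g b ≈ ⟦ k ∣? m ⟧ g (m div k)
  sumTo-*≟ N k m g 1≤k 1≤m m≤N with k ∣? m
  ... | yes (divides q m≡q*k) =
    trans (sumTo-single N q 1≤q q≤N (λ x _ _ x≢q → ⟦⟧-no (k *ℕ x ≟ m) (λ eq → x≢q (*-cancelˡ-≡⁺ x q 1≤k (≡.trans eq m≡k*q)))))
          (trans (⟦⟧-yes (k *ℕ q ≟ m) (≡.sym m≡k*q)) (reflexive (≡.cong g (≡.sym (div-≡ q k 1≤k m≡q*k)))))
    where
    m≡k*q = ≡.trans m≡q*k (ℕ.*-comm q k)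
    1≤q = ≡*⇒pos q 1≤m m≡q*k
    q≤N = factor-≤ˡ 1≤k (≡.sym m≡q*k) m≤N
  ... | no k∤m = sumTo-zero N (λ x _ _ → ⟦⟧-no (k *ℕ x ≟ m) (λ eq → k∤m (divides x (≡.trans (≡.sym eq) (ℕ.*-comm k x)))))

  sumTo-∣-reindex : ∀ N k (F : ℕ → Carrier) → 1 ≤ k → (∀ x → N < x → F x ≈ 0#) →
                    ∑[ e ≤ N ] ⟦ k ∣? e ⟧ F e ≈ ∑[ e ≤ N ] F (k *ℕ e)
  sumTo-∣-reindex N k F 1≤k beyond = sym (begin
    ∑[ e′ ≤ N ] F (k *ℕ e′)
      ≈⟨ sumTo-cong N (λ e′ 1≤e′ _ → sumTo-≟ N (k *ℕ e′) F (*-pos 1≤k 1≤e′) (beyond _)) ⟨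
    ∑[ e′ ≤ N ] ∑[ e ≤ N ] ⟦ e ≟ k *ℕ e′ ⟧ F e
      ≈⟨ sumTo-comm N N _ ⟩
    ∑[ e ≤ N ] ∑[ e′ ≤ N ] ⟦ e ≟ k *ℕ e′ ⟧ F e
      ≈⟨ sumTo-cong N (λ e 1≤e e≤N → trans (sumTo-cong N (λ e′ _ _ → flip e e′)) (sumTo-*≟ N k e (λ _ → F e) 1≤k 1≤e e≤N)) ⟩
    ∑[ e ≤ N ] ⟦ k ∣? e ⟧ F e ∎)
    where
    flip : ∀ e e′ → ⟦ e ≟ k *ℕ e′ ⟧ F e ≈ ⟦ k *ℕ e′ ≟ e ⟧ F e
    flip e e′ = ⟦⟧-⇔ (e ≟ k *ℕ e′) (k *ℕ e′ ≟ e) ≡.sym ≡.sym (λ _ → refl)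

  sumTo-rotate : ∀ N (g : ℕ → ℕ → ℕ → Carrier) →
                 ∑[ x ≤ N ] ∑[ y ≤ N ] ∑[ z ≤ N ] g x y z ≈ ∑[ z ≤ N ] ∑[ x ≤ N ] ∑[ y ≤ N ] g x y z
  sumTo-rotate N g = trans (sumTo-cong N (λ x _ _ → sumTo-comm N N (g x))) (sumTo-comm N N _)

  sumTo²-≟ : ∀ N s t (g : ℕ → ℕ → Carrier) → 1 ≤ s → 1 ≤ t → (N < s ⊎ N < t → g s t ≈ 0#) →
             ∑[ x ≤ N ] ∑[ y ≤ N ] ⟦ x ≟ s ⟧ ⟦ y ≟ t ⟧ g x y ≈ g s t
  sumTo²-≟ N s t g 1≤s 1≤t beyond = begin
    ∑[ x ≤ N ] ∑[ y ≤ N ] ⟦ x ≟ s ⟧ ⟦ y ≟ t ⟧ g x y ≈⟨ sumTo-cong N (λ x _ _ → ⟦⟧-sumTo N (x ≟ s) _) ⟨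
    ∑[ x ≤ N ] ⟦ x ≟ s ⟧ ∑[ y ≤ N ] ⟦ y ≟ t ⟧ g x y ≈⟨ sumTo-≟ N s _ 1≤s (λ N<s → trans inner (beyond (inj₁ N<s))) ⟩
    ∑[ y ≤ N ] ⟦ y ≟ t ⟧ g s y                      ≈⟨ inner ⟩
    g s t                                           ∎
    where
    inner : ∑[ y ≤ N ] ⟦ y ≟ t ⟧ g s y ≈ g s t
    inner = sumTo-≟ N t (g s) 1≤t (λ N<t → beyond (inj₂ N<t))

  -- Groups the pairs (b , c) by m = φ b c; m ≤ ψ m keeps every m with ψ m ≡ n within the range.
  sumTo²-fibres : ∀ N {n} (ψ : ℕ → ℕ) (φ : ℕ → ℕ → ℕ) (Φ : ℕ → ℕ → Carrier) → n ≤ N → (∀ m → m ≤ ψ m) →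
                  (∀ b c → 1 ≤ b → 1 ≤ c → 1 ≤ φ b c) →
                  ∑[ b ≤ N ] ∑[ c ≤ N ] ⟦ ψ (φ b c) ≟ n ⟧ Φ b c
                    ≈ ∑[ m ≤ N ] ⟦ ψ m ≟ n ⟧ ∑[ b ≤ N ] ∑[ c ≤ N ] ⟦ φ b c ≟ m ⟧ Φ b c
  sumTo²-fibres N {n} ψ φ Φ n≤N m≤ψm φ-pos = sym (begin
    ∑[ m ≤ N ] ⟦ ψ m ≟ n ⟧ ∑[ b ≤ N ] ∑[ c ≤ N ] ⟦ φ b c ≟ m ⟧ Φ b c
      ≈⟨ sumTo-cong N (λ m _ _ → trans (⟦⟧-sumTo N (ψ m ≟ n) _) (sumTo-cong N (λ b _ _ → ⟦⟧-sumTo N (ψ m ≟ n) _))) ⟩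
    ∑[ m ≤ N ] ∑[ b ≤ N ] ∑[ c ≤ N ] ⟦ ψ m ≟ n ⟧ ⟦ φ b c ≟ m ⟧ Φ b c
      ≈⟨ sumTo-rotate N _ ⟨
    ∑[ b ≤ N ] ∑[ c ≤ N ] ∑[ m ≤ N ] ⟦ ψ m ≟ n ⟧ ⟦ φ b c ≟ m ⟧ Φ b c
      ≈⟨ sumTo-cong N (λ b 1≤b _ → sumTo-cong N (λ c 1≤c _ → fibre b c 1≤b 1≤c)) ⟩
    ∑[ b ≤ N ] ∑[ c ≤ N ] ⟦ ψ (φ b c) ≟ n ⟧ Φ b c ∎)
    where
    fibre : ∀ b c → 1 ≤ b → 1 ≤ c → ∑[ m ≤ N ] ⟦ ψ m ≟ n ⟧ ⟦ φ b c ≟ m ⟧ Φ b c ≈ ⟦ ψ (φ b c) ≟ n ⟧ Φ b c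
    fibre b c 1≤b 1≤c = trans
      (sumTo-cong N (λ m _ _ → ⟦⟧-nest-⇔ (ψ m ≟ n) (φ b c ≟ m) (m ≟ φ b c) (ψ m ≟ n) (λ (x , y) → ≡.sym y , x) (λ (x , y) → y , ≡.sym x)))
      (sumTo-≟ N (φ b c) (λ m → ⟦ ψ m ≟ n ⟧ Φ b c) (φ-pos b c 1≤b 1≤c)
        (λ N<φ → ⟦⟧-no (ψ (φ b c) ≟ n) (λ eq → ℕ.<⇒≱ N<φ (ℕ.≤-trans (m≤ψm (φ b c)) (ℕ.≤-trans (ℕ.≤-reflexive eq) n≤N)))))

-- Counting on ℕ: ω and squarefreeness

module _ where

  open FiniteSums ℕ.+-0-commutativeMonoid

  count-sumTo : ∀ {p} {P : Pred ℕ p} (P? : Decidable P) N → length (filter P? (rng N)) ≡ ∑[ x ≤ N ] ⟦ P? x ⟧ 1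
  count-sumTo P? N = ≡.trans (count-foldr (rng N)) (foldr-rng N (λ x → ⟦ P? x ⟧ 1))
    where
    count-foldr : ∀ xs → length (filter P? xs) ≡ foldr (λ x acc → (⟦ P? x ⟧ 1) +ℕ acc) 0 xs
    count-foldr []       = ≡.refl
    count-foldr (x ∷ xs) with P? x
    ... | yes _ = ≡.cong suc (count-foldr xs)
    ... | no  _ = count-foldr xs

  sumTo≡0⇒ : ∀ N {g x} → sumTo N g ≡ 0 → 1 ≤ x → x ≤ N → g x ≡ 0
  sumTo≡0⇒ zero    {x = suc _} _ _ ()
  sumTo≡0⇒ (suc N) {g} {x} sum≡0 1≤x x≤1+N with x ≟ suc N
  ... | yes ≡.refl = ℕ.m+n≡0⇒n≡0 (sumTo N g) sum≡0
  ... | no  x≢    = sumTo≡0⇒ N (ℕ.m+n≡0⇒m≡0 (sumTo N g) sum≡0) 1≤x (ℕ.≤-pred (ℕ.≤∧≢⇒< x≤1+N x≢))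

  ⟦⟧1≡0⇒ : ∀ {p} {A : Set p} (d : Dec A) → ⟦ d ⟧ 1 ≡ 0 → ¬ A
  ⟦⟧1≡0⇒ (no ¬a) _ = ¬a

  prime-divisor? : ∀ n p → Dec (Prime p × p ∣ n)
  prime-divisor? n p = prime? p ×-dec (p ∣? n)

  ω-sumTo : ∀ {n} M → 1 ≤ n → n ≤ M → ω n ≡ ∑[ p ≤ M ] ⟦ prime-divisor? n p ⟧ 1
  ω-sumTo {n} M 1≤n n≤M = ≡.trans (count-sumTo (prime-divisor? n) n)
    (≡.sym (sumTo-extend n M n≤M (λ x n<x _ → ⟦⟧-no (prime-divisor? n x) (λ (_ , x∣n) → ℕ.<⇒≱ n<x (∣⇒≤⁺ 1≤n x∣n)))))

  ω-*-prime-∤ : ∀ {p d} → Prime p → ¬ p ∣ d → 1 ≤ d → ω (p *ℕ d) ≡ suc (ω d)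
  ω-*-prime-∤ {p} {d} pp p∤d 1≤d = begin
    ω (p *ℕ d)
      ≡⟨ ω-sumTo (p *ℕ d) (*-pos 1≤p 1≤d) ℕ.≤-refl ⟩
    ∑[ q ≤ p *ℕ d ] ⟦ prime-divisor? (p *ℕ d) q ⟧ 1
      ≡⟨ sumTo-cong (p *ℕ d) (λ q _ _ → split q) ⟩
    ∑[ q ≤ p *ℕ d ] ((⟦ prime-divisor? d q ⟧ 1) +ℕ (⟦ q ≟ p ⟧ 1))
      ≡⟨ sumTo-+ (p *ℕ d) _ _ ⟩
    (∑[ q ≤ p *ℕ d ] ⟦ prime-divisor? d q ⟧ 1) +ℕ (∑[ q ≤ p *ℕ d ] ⟦ q ≟ p ⟧ 1)
      ≡⟨ ≡.cong₂ _+ℕ_ (≡.sym (ω-sumTo (p *ℕ d) 1≤d (m≤n*m⁺ d 1≤p)))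
                      (sumTo-≟ (p *ℕ d) p (λ _ → 1) 1≤p (λ pd<p → ⊥-elim (ℕ.<⇒≱ pd<p (m≤m*n⁺ p 1≤d)))) ⟩
    ω d +ℕ 1
      ≡⟨ ℕ.+-comm (ω d) 1 ⟩
    suc (ω d) ∎
    where
    open ≡.≡-Reasoning
    1≤p = prime-pos pp
    split : ∀ q → ⟦ prime-divisor? (p *ℕ d) q ⟧ 1 ≡ (⟦ prime-divisor? d q ⟧ 1) +ℕ (⟦ q ≟ p ⟧ 1)
    split q = ⟦⟧-⊎ (prime-divisor? (p *ℕ d) q) (prime-divisor? d q) (q ≟ p)
      (λ (pq , q∣pd) → [ (λ q∣p → inj₂ (prime∣prime⇒≡ pq pp q∣p)) , (λ q∣d → inj₁ (pq , q∣d)) ] (euclidsLemma p d pq q∣pd))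
      [ (λ (pq , q∣d) → pq , ∣n⇒∣m*n p q∣d) , (λ { ≡.refl → pp , m∣m*n d }) ]
      (λ { (_ , p∣d) ≡.refl → p∤d p∣d })

  ω-*-prime-∣ : ∀ {p d} → Prime p → p ∣ d → 1 ≤ d → ω (p *ℕ d) ≡ ω d
  ω-*-prime-∣ {p} {d} pp p∣d 1≤d = begin
    ω (p *ℕ d)                                      ≡⟨ ω-sumTo (p *ℕ d) (*-pos 1≤p 1≤d) ℕ.≤-refl ⟩
    ∑[ q ≤ p *ℕ d ] ⟦ prime-divisor? (p *ℕ d) q ⟧ 1 ≡⟨ sumTo-cong (p *ℕ d) (λ q _ _ → same q) ⟩
    ∑[ q ≤ p *ℕ d ] ⟦ prime-divisor? d q ⟧ 1        ≡⟨ ω-sumTo (p *ℕ d) 1≤d (m≤n*m⁺ d 1≤p) ⟨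
    ω d                                             ∎
    where
    open ≡.≡-Reasoning
    1≤p = prime-pos pp
    same : ∀ q → ⟦ prime-divisor? (p *ℕ d) q ⟧ 1 ≡ ⟦ prime-divisor? d q ⟧ 1
    same q = ⟦⟧-⇔ (prime-divisor? (p *ℕ d) q) (prime-divisor? d q)
      (λ (pq , q∣pd) → pq , [ (λ q∣p → ≡.subst (_∣ d) (≡.sym (prime∣prime⇒≡ pq pp q∣p)) p∣d) , (λ q∣d → q∣d) ] (euclidsLemma p d pq q∣pd))
      (λ (pq , q∣d) → pq , ∣n⇒∣m*n p q∣d)
      (λ _ → ≡.refl)

  Squarefree : Pred ℕ _
  Squarefree n = ∀ d → 2 ≤ d → ¬ (d *ℕ d ∣ n)

  square-divisor? : ∀ n d → Dec (2 ≤ d × d *ℕ d ∣ n)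
  square-divisor? n d = (2 ≤? d) ×-dec (d *ℕ d ∣? n)

  sqDivCount≡0⇒squarefree : ∀ {n} → 1 ≤ n → sqDivCount n ≡ 0 → Squarefree n
  sqDivCount≡0⇒squarefree {n} 1≤n count≡0 d 2≤d dd∣n =
    ⟦⟧1≡0⇒ (square-divisor? n d) (sumTo≡0⇒ n (≡.trans (≡.sym (count-sumTo (square-divisor? n) n)) count≡0) 1≤d d≤n) (2≤d , dd∣n)
    where
    1≤d = ℕ.≤-trans (s≤s z≤n) 2≤d
    d≤n = ℕ.≤-trans (m≤m*n⁺ d 1≤d) (∣⇒≤⁺ 1≤n dd∣n)

  squarefree⇒sqDivCount≡0 : ∀ {n} → Squarefree n → sqDivCount n ≡ 0
  squarefree⇒sqDivCount≡0 {n} sf = ≡.trans (count-sumTo (square-divisor? n) n)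
    (sumTo-zero n (λ d _ _ → ⟦⟧-no (square-divisor? n d) (λ (2≤d , dd∣n) → sf d 2≤d dd∣n)))

squarefree-*-prime : ∀ {p d} → Prime p → ¬ p ∣ d → Squarefree d → Squarefree (p *ℕ d)
squarefree-*-prime {p} {d} pp p∤d sf e 2≤e ee∣pd with p ∣? e
... | yes p∣e = p∤d (*-cancelˡ-∣ p {{>-nonZero (prime-pos pp)}} (∣-trans (*-pres-∣ p∣e p∣e) ee∣pd))
... | no  p∤e = sf e 2≤e (coprime-divisor (Coprime.sym (prime∤⇒coprime pp p∤ee)) ee∣pd)
  where p∤ee = λ p∣ee → [ p∤e , p∤e ] (euclidsLemma e e pp p∣ee)

squarefree-*⁻ : ∀ p {d} → Squarefree (p *ℕ d) → Squarefree d
squarefree-*⁻ p sf e 2≤e ee∣d = sf e 2≤e (∣n⇒∣m*n p ee∣d)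

¬squarefree-*-prime-∣ : ∀ {p d} → Prime p → p ∣ d → ¬ Squarefree (p *ℕ d)
¬squarefree-*-prime-∣ {p} pp p∣d sf = sf p (prime≥2 pp) (*-monoʳ-∣ p p∣d)

CoprimeFactors : ℕ → ℕ → ℕ → Set
CoprimeFactors m u v = u *ℕ v ≡ m × Coprime u v

coprimeFactors? : ∀ m u v → Dec (CoprimeFactors m u v)
coprimeFactors? m u v = (u *ℕ v ≟ m) ×-dec coprime? u v

coprimeFactors-comm : ∀ {m u v} → CoprimeFactors m u v → CoprimeFactors m v u
coprimeFactors-comm {u = u} {v} (uv≡m , u⊥v) = ≡.trans (ℕ.*-comm v u) uv≡m , Coprime.sym u⊥v

module _ {p m h} (pp : Prime p) (m≡p*h : m ≡ p *ℕ h) where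

  coprimeFactors-p*⇒ : ∀ {u v} → CoprimeFactors m (p *ℕ u) v → CoprimeFactors h u v × ¬ p ∣ v
  coprimeFactors-p*⇒ {u} {v} (puv≡m , pu⊥v) =
    (*-cancelˡ-≡⁺ (u *ℕ v) h (prime-pos pp) (≡.trans (≡.sym (ℕ.*-assoc p u v)) (≡.trans puv≡m m≡p*h)) , proj₁ (coprime-p*⇒ pp pu⊥v)) ,
    proj₂ (coprime-p*⇒ pp pu⊥v)

  coprimeFactors-p*⇐ : ∀ {u v} → CoprimeFactors h u v × ¬ p ∣ v → CoprimeFactors m (p *ℕ u) v
  coprimeFactors-p*⇐ {u} {v} ((uv≡h , u⊥v) , p∤v) =
    ≡.trans (ℕ.*-assoc p u v) (≡.trans (≡.cong (p *ℕ_) uv≡h) (≡.sym m≡p*h)) , coprime-p*⇐ pp u⊥v p∤v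

module _ {c ℓ : Level} (R : CommutativeRing c ℓ) where

  open Arith R
  open FiniteSums +-commutativeMonoid
  open import Algebra.Properties.Ring ring using (-1*x≈-x; -0#≈0#)
  open import Algebra.Properties.Group +-group using (x≈z//y)
  open import Algebra.Properties.CommutativeSemigroup +-commutativeSemigroup using (interchange)
  open import Relation.Binary.Reasoning.Setoid setoid

  ⟦⟧-*ˡ : ∀ {p} {A : Set p} (d : Dec A) {x y} → y * (⟦ d ⟧ x) ≈ ⟦ d ⟧ (y * x)
  ⟦⟧-*ˡ (yes _) = refl
  ⟦⟧-*ˡ (no _)  = zeroʳ _

  ⟦⟧-*ʳ : ∀ {p} {A : Set p} (d : Dec A) {x y} → (⟦ d ⟧ x) * y ≈ ⟦ d ⟧ (x * y)
  ⟦⟧-*ʳ (yes _) = refl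
  ⟦⟧-*ʳ (no _)  = zeroˡ _

  ⟦⟧-neg : ∀ {p} {A : Set p} (d : Dec A) {x} → ⟦ d ⟧ - x ≈ - (⟦ d ⟧ x)
  ⟦⟧-neg (yes _) = refl
  ⟦⟧-neg (no _)  = sym -0#≈0#

  *-sumToˡ : ∀ N a g → a * sumTo N g ≈ ∑[ x ≤ N ] a * g x
  *-sumToˡ zero    a g = zeroʳ a
  *-sumToˡ (suc N) a g = trans (distribˡ a _ _) (+-congʳ (*-sumToˡ N a g))

  *-sumToʳ : ∀ N a g → sumTo N g * a ≈ ∑[ x ≤ N ] g x * a
  *-sumToʳ N a g = trans (*-comm _ a) (trans (*-sumToˡ N a g) (sumTo-cong N (λ x _ _ → *-comm a (g x))))

  sum2-sumTo : ∀ n g → sum2 n g ≈ ∑[ a ≤ n ] ∑[ b ≤ n ] ⟦ a *ℕ b ≟ n ⟧ g a b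
  sum2-sumTo n g = trans (foldr-rng n _) (sumTo-cong n (λ a _ _ → foldr-rng n _))

  sumSq-sumTo : ∀ n g → sumSq n g ≈ ∑[ a ≤ n ] ∑[ c ≤ n ] ⟦ a *ℕ a *ℕ c ≟ n ⟧ g a c
  sumSq-sumTo n g = trans (foldr-rng n _) (sumTo-cong n (λ a _ _ → foldr-rng n _))

  sum3-sumTo : ∀ n g → sum3 n g ≈ ∑[ a ≤ n ] ∑[ b ≤ n ] ∑[ c ≤ n ] ⟦ a *ℕ a *ℕ b *ℕ b *ℕ c ≟ n ⟧ g a b c
  sum3-sumTo n g = trans (foldr-rng n _) (sumTo-cong n (λ a _ _ → trans (foldr-rng n _) (sumTo-cong n (λ b _ _ → foldr-rng n _))))

  conv-sumTo : ∀ g h m → conv g h m ≈ ∑[ d ≤ m ] ⟦ d ∣? m ⟧ g d * h (m div d)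
  conv-sumTo g h m = foldr-rng m _

  nat-+ : ∀ a b → nat (a +ℕ b) ≈ nat a + nat b
  nat-+ zero    b = sym (+-identityˡ _)
  nat-+ (suc a) b = trans (+-congˡ (nat-+ a b)) (sym (+-assoc _ _ _))

  ·≈nat* : ∀ k x → k · x ≈ nat k * x
  ·≈nat* zero    x = sym (zeroˡ x)
  ·≈nat* (suc k) x = trans (+-cong (sym (*-identityˡ x)) (·≈nat* k x)) (sym (distribʳ x 1# (nat k)))

  nat-2^-suc : ∀ k → nat (2 ^ suc k) ≈ nat (2 ^ k) + nat (2 ^ k)
  nat-2^-suc k = trans (nat-+ (2 ^ k) (2 ^ k +ℕ 0)) (+-congˡ (reflexive (≡.cong nat (ℕ.+-identityʳ (2 ^ k)))))

  τ-sumTo : ∀ N {m} → 1 ≤ m → m ≤ N → nat (τ m) ≈ ∑[ u ≤ N ] ∑[ v ≤ N ] ⟦ u *ℕ v ≟ m ⟧ 1#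
  τ-sumTo N {m} 1≤m m≤N = begin
    nat (τ m)                              ≈⟨ nat-count (rng m) ⟩
    foldr _ 0# (rng m)                     ≈⟨ foldr-rng m _ ⟩
    ∑[ d ≤ m ] ⟦ d ∣? m ⟧ 1#               ≈⟨ sumTo-extend m N m≤N (λ x m<x _ → ⟦⟧-no (x ∣? m) (λ x∣m → ℕ.<⇒≱ m<x (∣⇒≤⁺ 1≤m x∣m)))  ⟨
    ∑[ d ≤ N ] ⟦ d ∣? m ⟧ 1#               ≈⟨ sumTo-cong N (λ u 1≤u _ → sumTo-*≟ N u m (λ _ → 1#) 1≤u 1≤m m≤N) ⟨
    ∑[ u ≤ N ] ∑[ v ≤ N ] ⟦ u *ℕ v ≟ m ⟧ 1# ∎
    where
    nat-count : ∀ xs → nat (length (filter (_∣? m) xs)) ≈ foldr (λ d acc → (⟦ d ∣? m ⟧ 1#) + acc) 0# xs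
    nat-count []       = refl
    nat-count (x ∷ xs) with x ∣? m
    ... | yes _ = +-congˡ (nat-count xs)
    ... | no  _ = trans (nat-count xs) (sym (+-identityˡ _))

  -- The Möbius function

  μ-squarefree : ∀ {n} → Squarefree n → μ n ≈ neg1^ (ω n)
  μ-squarefree {n} sf with sqDivCount n | squarefree⇒sqDivCount≡0 sf
  ... | zero | _ = refl

  μ-¬squarefree : ∀ {n} → 1 ≤ n → ¬ Squarefree n → μ n ≈ 0#
  μ-¬squarefree {n} 1≤n ¬sf with sqDivCount n in eq
  ... | zero  = ⊥-elim (¬sf (sqDivCount≡0⇒squarefree 1≤n eq))
  ... | suc _ = refl

  μ-*-prime-∣ : ∀ {p d} → Prime p → p ∣ d → 1 ≤ d → μ (p *ℕ d) ≈ 0#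
  μ-*-prime-∣ pp p∣d 1≤d = μ-¬squarefree (*-pos (prime-pos pp) 1≤d) (¬squarefree-*-prime-∣ pp p∣d)

  μ-*-prime-∤ : ∀ {p d} → Prime p → ¬ p ∣ d → 1 ≤ d → μ (p *ℕ d) ≈ - μ d
  μ-*-prime-∤ {p} {d} pp p∤d 1≤d with sqDivCount d ≟ 0
  ... | yes count≡0 = begin
    μ (p *ℕ d)           ≈⟨ μ-squarefree (squarefree-*-prime pp p∤d sf) ⟩
    neg1^ (ω (p *ℕ d))   ≡⟨ ≡.cong neg1^ (ω-*-prime-∤ pp p∤d 1≤d) ⟩
    - 1# * neg1^ (ω d)   ≈⟨ -1*x≈-x _ ⟩
    - neg1^ (ω d)        ≈⟨ -‿cong (μ-squarefree sf) ⟨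
    - μ d                ∎
    where sf = sqDivCount≡0⇒squarefree 1≤d count≡0
  ... | no count≢0 = begin
    μ (p *ℕ d)           ≈⟨ μ-¬squarefree (*-pos (prime-pos pp) 1≤d) (λ sf → ¬sf (squarefree-*⁻ p sf)) ⟩
    0#                   ≈⟨ zeroʳ _ ⟨
    - 1# * 0#            ≈⟨ -1*x≈-x _ ⟩
    - 0#                 ≈⟨ -‿cong (μ-¬squarefree 1≤d ¬sf) ⟨
    - μ d                ∎
    where ¬sf = λ sf → count≢0 (squarefree⇒sqDivCount≡0 sf)

  -- Pairing each divisor e of g = p q not divisible by p with p e makes the terms cancel.
  sumTo-μ-∣ : ∀ N {g} → 1 ≤ g → g ≤ N → ∑[ e ≤ N ] ⟦ e ∣? g ⟧ μ e ≈ ⟦ g ≟ 1 ⟧ 1#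
  sumTo-μ-∣ N {suc zero} _ 1≤N = sumTo-single N 1 (s≤s z≤n) 1≤N (λ x _ _ x≢1 → ⟦⟧-no (x ∣? 1) (λ x∣1 → x≢1 (∣1⇒≡1 x∣1)))
  sumTo-μ-∣ N {g@(suc (suc _))} _ g≤N with prime-divisor g (s≤s (s≤s z≤n))
  ... | p , pp , divides q g≡q*p = begin
    ∑[ e ≤ N ] ⟦ e ∣? g ⟧ μ e
      ≈⟨ sumTo-cong N (λ e _ _ → ⟦⟧-split (p ∣? e) _) ⟩
    ∑[ e ≤ N ] ((⟦ p ∣? e ⟧ ⟦ e ∣? g ⟧ μ e) + (⟦ ¬? (p ∣? e) ⟧ ⟦ e ∣? g ⟧ μ e))
      ≈⟨ sumTo-+ N _ _ ⟩
    (∑[ e ≤ N ] ⟦ p ∣? e ⟧ ⟦ e ∣? g ⟧ μ e) + (∑[ e ≤ N ] ⟦ ¬? (p ∣? e) ⟧ ⟦ e ∣? g ⟧ μ e)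
      ≈⟨ +-congʳ (sumTo-∣-reindex N p (λ e → ⟦ e ∣? g ⟧ μ e) 1≤p beyond) ⟩
    (∑[ e ≤ N ] ⟦ p *ℕ e ∣? g ⟧ μ (p *ℕ e)) + (∑[ e ≤ N ] ⟦ ¬? (p ∣? e) ⟧ ⟦ e ∣? g ⟧ μ e)
      ≈⟨ +-cong (sumTo-cong N (λ e 1≤e _ → multiples e 1≤e)) (sumTo-cong N (λ e _ _ → coprimes e)) ⟩
    (∑[ e ≤ N ] ⟦ e ∣? q ⟧ ⟦ ¬? (p ∣? e) ⟧ - μ e) + (∑[ e ≤ N ] ⟦ e ∣? q ⟧ ⟦ ¬? (p ∣? e) ⟧ μ e)
      ≈⟨ sumTo-+ N _ _ ⟨
    ∑[ e ≤ N ] ((⟦ e ∣? q ⟧ ⟦ ¬? (p ∣? e) ⟧ - μ e) + (⟦ e ∣? q ⟧ ⟦ ¬? (p ∣? e) ⟧ μ e))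
      ≈⟨ sumTo-zero N (λ e _ _ → cancel e) ⟩
    0#
      ≈⟨ ⟦⟧-no (g ≟ 1) {1#} (λ ()) ⟨
    ⟦ g ≟ 1 ⟧ 1# ∎
    where
    1≤p = prime-pos pp
    g≡p*q = ≡.trans g≡q*p (ℕ.*-comm q p)
    beyond : ∀ x → N < x → ⟦ x ∣? g ⟧ μ x ≈ 0#
    beyond x N<x = ⟦⟧-no (x ∣? g) (λ x∣g → ℕ.<⇒≱ N<x (ℕ.≤-trans (∣⇒≤⁺ (s≤s z≤n) x∣g) g≤N))
    multiples : ∀ e → 1 ≤ e → ⟦ p *ℕ e ∣? g ⟧ μ (p *ℕ e) ≈ ⟦ e ∣? q ⟧ ⟦ ¬? (p ∣? e) ⟧ - μ e
    multiples e 1≤e = ⟦⟧-⇔ (p *ℕ e ∣? g) (e ∣? q)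
      (λ pe∣g → *-cancelˡ-∣ p {{>-nonZero 1≤p}} (≡.subst (p *ℕ e ∣_) g≡p*q pe∣g))
      (λ e∣q → ≡.subst (p *ℕ e ∣_) (≡.sym g≡p*q) (*-monoʳ-∣ p e∣q))
      (λ _ → value (p ∣? e))
      where
      value : (d : Dec (p ∣ e)) → μ (p *ℕ e) ≈ ⟦ ¬? d ⟧ - μ e
      value (yes p∣e) = μ-*-prime-∣ pp p∣e 1≤e
      value (no  p∤e) = μ-*-prime-∤ pp p∤e 1≤e
    cancel : ∀ e → (⟦ e ∣? q ⟧ ⟦ ¬? (p ∣? e) ⟧ - μ e) + (⟦ e ∣? q ⟧ ⟦ ¬? (p ∣? e) ⟧ μ e) ≈ 0#
    cancel e = trans (+-congʳ (trans (⟦⟧-cong (e ∣? q) (λ _ → ⟦⟧-neg (¬? (p ∣? e)))) (⟦⟧-neg (e ∣? q)))) (-‿inverseˡ _)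
    coprimes : ∀ e → ⟦ ¬? (p ∣? e) ⟧ ⟦ e ∣? g ⟧ μ e ≈ ⟦ e ∣? q ⟧ ⟦ ¬? (p ∣? e) ⟧ μ e
    coprimes e with p ∣? e
    ... | yes _   = sym (⟦⟧-0 (e ∣? q))
    ... | no  p∤e = ⟦⟧-⇔ (e ∣? g) (e ∣? q)
      (λ e∣g → coprime-divisor (Coprime.sym (prime∤⇒coprime pp p∤e)) (≡.subst (e ∣_) g≡p*q e∣g))
      (λ e∣q → ≡.subst (e ∣_) (≡.sym g≡q*p) (∣-trans e∣q (m∣m*n p)))
      (λ _ → refl)

  -- Coprime factorisations

  coprimePairs : ℕ → ℕ → Carrier
  coprimePairs N m = ∑[ u ≤ N ] ∑[ v ≤ N ] ⟦ coprimeFactors? m u v ⟧ 1#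

  coprimePairs-1 : ∀ N → 1 ≤ N → coprimePairs N 1 ≈ 1#
  coprimePairs-1 N 1≤N =
    trans (sumTo-single N 1 (s≤s z≤n) 1≤N others)
          (trans (sumTo-single N 1 (s≤s z≤n) 1≤N others′) (⟦⟧-yes (coprimeFactors? 1 1 1) (≡.refl , Coprime.1-coprimeTo 1)))
    where
    others : ∀ u → 1 ≤ u → u ≤ N → u ≢ 1 → ∑[ v ≤ N ] ⟦ coprimeFactors? 1 u v ⟧ 1# ≈ 0#
    others u _ _ u≢1 = sumTo-zero N (λ v _ _ → ⟦⟧-no (coprimeFactors? 1 u v) (λ (uv≡1 , _) → u≢1 (ℕ.m*n≡1⇒m≡1 u v uv≡1)))
    others′ : ∀ v → 1 ≤ v → v ≤ N → v ≢ 1 → ⟦ coprimeFactors? 1 1 v ⟧ 1# ≈ 0#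
    others′ v _ _ v≢1 = ⟦⟧-no (coprimeFactors? 1 1 v) (λ (v≡1 , _) → v≢1 (ℕ.m*n≡1⇒n≡1 1 v v≡1))

  -- The prime p lies in exactly one of the coprime factors u, v of m = p h; removing it leaves
  -- a coprime factorisation of h.
  coprimePairs-*-prime : ∀ {p m h} N → Prime p → m ≡ p *ℕ h → m ≤ N →
    coprimePairs N m ≈ (∑[ u ≤ N ] ∑[ v ≤ N ] ⟦ coprimeFactors? h u v ×-dec ¬? (p ∣? v) ⟧ 1#)
                     + (∑[ u ≤ N ] ∑[ v ≤ N ] ⟦ coprimeFactors? h u v ×-dec ¬? (p ∣? u) ⟧ 1#)
  coprimePairs-*-prime {p} {m} {h} N pp m≡p*h m≤N = begin
    coprimePairs N m
      ≈⟨ sumTo-cong N (λ u _ _ → ⟦⟧-split (p ∣? u) _) ⟩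
    ∑[ u ≤ N ] ((⟦ p ∣? u ⟧ row u) + (⟦ ¬? (p ∣? u) ⟧ row u))
      ≈⟨ sumTo-+ N _ _ ⟩
    (∑[ u ≤ N ] ⟦ p ∣? u ⟧ row u) + (∑[ u ≤ N ] ⟦ ¬? (p ∣? u) ⟧ row u)
      ≈⟨ +-congʳ (sumTo-∣-reindex N p row 1≤p row-beyond) ⟩
    (∑[ u ≤ N ] row (p *ℕ u)) + (∑[ u ≤ N ] ⟦ ¬? (p ∣? u) ⟧ row u)
      ≈⟨ +-cong (sumTo-cong N (λ u _ _ → sumTo-cong N (λ v _ _ → p-in-u u v))) (sumTo-cong N (λ u 1≤u _ → p-in-v u 1≤u)) ⟩
    (∑[ u ≤ N ] ∑[ v ≤ N ] ⟦ coprimeFactors? h u v ×-dec ¬? (p ∣? v) ⟧ 1#)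
      + (∑[ u ≤ N ] ∑[ v ≤ N ] ⟦ coprimeFactors? h u v ×-dec ¬? (p ∣? u) ⟧ 1#) ∎
    where
    1≤p = prime-pos pp
    row : ℕ → Carrier
    row u = ∑[ v ≤ N ] ⟦ coprimeFactors? m u v ⟧ 1#
    row-beyond : ∀ u → N < u → row u ≈ 0#
    row-beyond u N<u = sumTo-zero N λ v 1≤v _ → ⟦⟧-no (coprimeFactors? m u v) λ (uv≡m , _) →
      ℕ.<⇒≱ N<u (factor-≤ˡ 1≤v uv≡m m≤N)
    p-in-u : ∀ u v → ⟦ coprimeFactors? m (p *ℕ u) v ⟧ 1# ≈ ⟦ coprimeFactors? h u v ×-dec ¬? (p ∣? v) ⟧ 1#
    p-in-u u v = ⟦⟧-⇔ (coprimeFactors? m (p *ℕ u) v) (coprimeFactors? h u v ×-dec ¬? (p ∣? v))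
      (coprimeFactors-p*⇒ pp m≡p*h) (coprimeFactors-p*⇐ pp m≡p*h) (λ _ → refl)
    p-in-v : ∀ u → 1 ≤ u → ⟦ ¬? (p ∣? u) ⟧ row u ≈ ∑[ v ≤ N ] ⟦ coprimeFactors? h u v ×-dec ¬? (p ∣? u) ⟧ 1#
    p-in-v u 1≤u with p ∣? u
    ... | yes p∣u = sym (sumTo-zero N (λ v _ _ → ⟦⟧-no (coprimeFactors? h u v ×-dec no _) (λ (_ , p∤u) → p∤u p∣u)))
    ... | no  p∤u = begin
      row u
        ≈⟨ sumTo-cong N (λ v _ _ → trans (⟦⟧-⇔ (coprimeFactors? m u v) (p ∣? v ×-dec coprimeFactors? m u v) p∣v proj₂ (λ _ → refl))
                                         (sym (⟦⟧-nest (p ∣? v) (coprimeFactors? m u v)))) ⟩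
      ∑[ v ≤ N ] ⟦ p ∣? v ⟧ ⟦ coprimeFactors? m u v ⟧ 1#
        ≈⟨ sumTo-∣-reindex N p _ 1≤p (λ v N<v → ⟦⟧-no (coprimeFactors? m u v) λ (uv≡m , _) →
             ℕ.<⇒≱ N<v (factor-≤ʳ 1≤u uv≡m m≤N)) ⟩
      ∑[ v ≤ N ] ⟦ coprimeFactors? m u (p *ℕ v) ⟧ 1#
        ≈⟨ sumTo-cong N (λ v _ _ → ⟦⟧-⇔ (coprimeFactors? m u (p *ℕ v)) (coprimeFactors? h u v ×-dec yes p∤u)
             (λ cf → let (cf′ , p∤u′) = coprimeFactors-p*⇒ pp m≡p*h (coprimeFactors-comm cf) in coprimeFactors-comm cf′ , p∤u′)
             (λ (cf′ , p∤u′) → coprimeFactors-comm (coprimeFactors-p*⇐ pp m≡p*h (coprimeFactors-comm cf′ , p∤u′)))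
             (λ _ → refl)) ⟩
      ∑[ v ≤ N ] ⟦ coprimeFactors? h u v ×-dec yes p∤u ⟧ 1# ∎
      where
      p∣v : ∀ {v} → CoprimeFactors m u v → p ∣ v × CoprimeFactors m u v
      p∣v {v} cf@(uv≡m , _) = [ (λ p∣u → ⊥-elim (p∤u p∣u)) , (λ p∣v → p∣v) ]
        (euclidsLemma u v pp (≡.subst (p ∣_) (≡.trans (≡.sym m≡p*h) (≡.sym uv≡m)) (m∣m*n h))) , cf

  coprimePairs≈2^ω : ∀ N {m} → 1 ≤ m → m ≤ N → coprimePairs N m ≈ nat (2 ^ ω m)
  coprimePairs≈2^ω N {m} = <-rec (λ m → 1 ≤ m → m ≤ N → coprimePairs N m ≈ nat (2 ^ ω m)) step m
    where
    step : ∀ m → (∀ {h} → h < m → 1 ≤ h → h ≤ N → coprimePairs N h ≈ nat (2 ^ ω h)) →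
           1 ≤ m → m ≤ N → coprimePairs N m ≈ nat (2 ^ ω m)
    step (suc zero) _ _ 1≤N = trans (coprimePairs-1 N 1≤N) (sym (+-identityʳ 1#))
    step m@(suc (suc _)) rec 1≤m m≤N with prime-divisor m (s≤s (s≤s z≤n))
    ... | p , pp , divides h m≡h*p = trans (coprimePairs-*-prime N pp m≡p*h m≤N) (by-cases (p ∣? h))
      where
      m≡p*h = ≡.trans m≡h*p (ℕ.*-comm h p)
      1≤h = ≡*⇒pos h 1≤m m≡h*p
      h<m = ℕ.<-≤-trans (ℕ.m<m*n h p {{>-nonZero 1≤h}} (prime≥2 pp)) (ℕ.≤-reflexive (≡.sym m≡h*p))
      IH : coprimePairs N h ≈ nat (2 ^ ω h)
      IH = rec h<m 1≤h (ℕ.≤-trans (ℕ.<⇒≤ h<m) m≤N)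
      avoids-v = λ u v → coprimeFactors? h u v ×-dec ¬? (p ∣? v)
      avoids-u = λ u v → coprimeFactors? h u v ×-dec ¬? (p ∣? u)
      by-cases : Dec (p ∣ h) → (∑[ u ≤ N ] ∑[ v ≤ N ] ⟦ avoids-v u v ⟧ 1#) + (∑[ u ≤ N ] ∑[ v ≤ N ] ⟦ avoids-u u v ⟧ 1#) ≈ nat (2 ^ ω m)
      by-cases (yes p∣h) = begin
        (∑[ u ≤ N ] ∑[ v ≤ N ] ⟦ avoids-v u v ⟧ 1#) + (∑[ u ≤ N ] ∑[ v ≤ N ] ⟦ avoids-u u v ⟧ 1#)
          ≈⟨ trans (sumTo-cong N (λ u _ _ → sumTo-+ N _ _)) (sumTo-+ N _ _) ⟨
        ∑[ u ≤ N ] ∑[ v ≤ N ] ((⟦ avoids-v u v ⟧ 1#) + (⟦ avoids-u u v ⟧ 1#))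
          ≈⟨ sumTo-cong N (λ u _ _ → sumTo-cong N (λ v _ _ → exactly-one u v)) ⟨
        coprimePairs N h
          ≈⟨ IH ⟩
        nat (2 ^ ω h)
          ≡⟨ ≡.cong (λ k → nat (2 ^ k)) (≡.trans (≡.cong ω m≡p*h) (ω-*-prime-∣ pp p∣h 1≤h)) ⟨
        nat (2 ^ ω m) ∎
        where
        one-side : ∀ {u v} → CoprimeFactors h u v → (CoprimeFactors h u v × ¬ p ∣ v) ⊎ (CoprimeFactors h u v × ¬ p ∣ u)
        one-side {u} {v} cf@(_ , u⊥v) with p ∣? v
        ... | yes p∣v = inj₂ (cf , λ p∣u → ℕ.<⇒≢ (prime≥2 pp) (≡.sym (u⊥v (p∣u , p∣v))))
        ... | no  p∤v = inj₁ (cf , p∤v)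
        exactly-one : ∀ u v → ⟦ coprimeFactors? h u v ⟧ 1# ≈ (⟦ avoids-v u v ⟧ 1#) + (⟦ avoids-u u v ⟧ 1#)
        exactly-one u v = ⟦⟧-⊎ (coprimeFactors? h u v) (avoids-v u v) (avoids-u u v)
          one-side
          [ proj₁ , proj₁ ]
          (λ ((uv≡h , _) , p∤v) (_ , p∤u) → [ p∤u , p∤v ] (euclidsLemma u v pp (≡.subst (p ∣_) (≡.sym uv≡h) p∣h)))
      by-cases (no p∤h) = begin
        (∑[ u ≤ N ] ∑[ v ≤ N ] ⟦ avoids-v u v ⟧ 1#) + (∑[ u ≤ N ] ∑[ v ≤ N ] ⟦ avoids-u u v ⟧ 1#)
          ≈⟨ +-cong (sumTo-cong N (λ u _ _ → sumTo-cong N (λ v _ _ → always (avoids-v u v)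
                      (λ (uv≡h , _) p∣v → p∤h (≡.subst (p ∣_) uv≡h (∣n⇒∣m*n u p∣v))))))
                    (sumTo-cong N (λ u _ _ → sumTo-cong N (λ v _ _ → always (avoids-u u v)
                      (λ (uv≡h , _) p∣u → p∤h (≡.subst (p ∣_) uv≡h (∣m⇒∣m*n v p∣u)))))) ⟩
        coprimePairs N h + coprimePairs N h
          ≈⟨ +-cong IH IH ⟩
        nat (2 ^ ω h) + nat (2 ^ ω h)
          ≈⟨ nat-2^-suc (ω h) ⟨
        nat (2 ^ suc (ω h))
          ≡⟨ ≡.cong (λ k → nat (2 ^ k)) (≡.trans (≡.cong ω m≡p*h) (ω-*-prime-∤ pp p∤h 1≤h)) ⟨
        nat (2 ^ ω m) ∎
        where
        always : ∀ {u v} {P : Set} (d : Dec (CoprimeFactors h u v × ¬ P)) → (CoprimeFactors h u v → ¬ P) → ⟦ d ⟧ 1# ≈ ⟦ coprimeFactors? h u v ⟧ 1#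
        always {u} {v} d ok = ⟦⟧-⇔ d (coprimeFactors? h u v) proj₁ (λ cf → cf , ok cf) (λ _ → refl)

  *-sumTo²-fibre : ∀ N F m (φ : ℕ → ℕ → ℕ) (Φ : ℕ → ℕ → Carrier) →
    F * (∑[ b ≤ N ] ∑[ c ≤ N ] ⟦ φ b c ≟ m ⟧ Φ b c) ≈ ∑[ b ≤ N ] ∑[ c ≤ N ] ⟦ φ b c ≟ m ⟧ F * Φ b c
  *-sumTo²-fibre N F m φ Φ =
    trans (*-sumToˡ N F _) (sumTo-cong N (λ b _ _ → trans (*-sumToˡ N F _) (sumTo-cong N (λ c _ _ → ⟦⟧-*ˡ (φ b c ≟ m)))))

  -- Möbius inversion of the coprimality condition: [gcd u v ≡ 1] = Σ_{e ∣ u, e ∣ v} μ e.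
  coprimePairs-μ : ∀ N {m u v} → 1 ≤ u → u ≤ N →
    ∑[ e ≤ N ] ⟦ e ∣? u ⟧ ⟦ e ∣? v ⟧ ⟦ u *ℕ v ≟ m ⟧ μ e ≈ ⟦ coprimeFactors? m u v ⟧ 1#
  coprimePairs-μ N {m} {u} {v} 1≤u u≤N = sym (begin
    ⟦ coprimeFactors? m u v ⟧ 1#
      ≈⟨ ⟦⟧-nest (u *ℕ v ≟ m) (coprime? u v) ⟨
    ⟦ u *ℕ v ≟ m ⟧ ⟦ coprime? u v ⟧ 1#
      ≈⟨ ⟦⟧-cong (u *ℕ v ≟ m) (λ _ → ⟦⟧-⇔ (coprime? u v) (gcd u v ≟ 1) coprime⇒gcd≡1 gcd≡1⇒coprime (λ _ → refl)) ⟩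
    ⟦ u *ℕ v ≟ m ⟧ ⟦ gcd u v ≟ 1 ⟧ 1#
      ≈⟨ ⟦⟧-cong (u *ℕ v ≟ m) (λ _ → sumTo-μ-∣ N (gcd-pos u v 1≤u) (ℕ.≤-trans (∣⇒≤⁺ 1≤u (gcd[m,n]∣m u v)) u≤N)) ⟨
    ⟦ u *ℕ v ≟ m ⟧ ∑[ e ≤ N ] ⟦ e ∣? gcd u v ⟧ μ e
      ≈⟨ ⟦⟧-sumTo N (u *ℕ v ≟ m) _ ⟩
    ∑[ e ≤ N ] ⟦ u *ℕ v ≟ m ⟧ ⟦ e ∣? gcd u v ⟧ μ e
      ≈⟨ sumTo-cong N (λ e _ _ → trans
           (⟦⟧-nest-⇔ (u *ℕ v ≟ m) (e ∣? gcd u v) (e ∣? u) (e ∣? v ×-dec u *ℕ v ≟ m)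
              (λ (uv≡m , e∣g) → ∣-trans e∣g (gcd[m,n]∣m u v) , ∣-trans e∣g (gcd[m,n]∣n u v) , uv≡m)
              (λ (e∣u , e∣v , uv≡m) → uv≡m , gcd-greatest e∣u e∣v))
           (⟦⟧-cong (e ∣? u) (λ _ → sym (⟦⟧-nest (e ∣? v) (u *ℕ v ≟ m))))) ⟩
    ∑[ e ≤ N ] ⟦ e ∣? u ⟧ ⟦ e ∣? v ⟧ ⟦ u *ℕ v ≟ m ⟧ μ e ∎)

  sumTo-μτ≈coprimePairs : ∀ N {m} → m ≤ N →
    ∑[ b ≤ N ] ∑[ c ≤ N ] ⟦ b *ℕ b *ℕ c ≟ m ⟧ μ b * nat (τ c) ≈ coprimePairs N m
  sumTo-μτ≈coprimePairs N {m} m≤N = begin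
    ∑[ b ≤ N ] ∑[ c ≤ N ] ⟦ b *ℕ b *ℕ c ≟ m ⟧ μ b * nat (τ c)
      ≈⟨ sumTo-cong N (λ b _ _ → sumTo-cong N (λ c 1≤c c≤N → ⟦⟧-cong (b *ℕ b *ℕ c ≟ m) (λ _ →
           trans (*-congˡ (τ-sumTo N 1≤c c≤N)) (*-sumTo²-fibre N (μ b) c _*ℕ_ (λ _ _ → 1#))))) ⟩
    ∑[ b ≤ N ] ∑[ c ≤ N ] ⟦ b *ℕ b *ℕ c ≟ m ⟧ ∑[ u ≤ N ] ∑[ v ≤ N ] ⟦ u *ℕ v ≟ c ⟧ μ b * 1#
      ≈⟨ sumTo-cong N (λ b 1≤b _ → sumTo²-fibres N (b *ℕ b *ℕ_) _*ℕ_ (λ _ _ → μ b * 1#) m≤N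
           (λ c → m≤n*m⁺ c (*-pos 1≤b 1≤b)) (λ _ _ → *-pos)) ⟨
    ∑[ b ≤ N ] ∑[ u ≤ N ] ∑[ v ≤ N ] ⟦ b *ℕ b *ℕ (u *ℕ v) ≟ m ⟧ μ b * 1#
      ≈⟨ sumTo-cong N (λ e _ _ → sumTo-cong N (λ u _ _ → sumTo-cong N (λ v _ _ →
           trans (⟦≟⟧-cong m (regroup e u v)) (⟦⟧-cong (e *ℕ u *ℕ (e *ℕ v) ≟ m) (λ _ → *-identityʳ (μ e)))))) ⟩
    ∑[ e ≤ N ] ∑[ u ≤ N ] ∑[ v ≤ N ] ⟦ e *ℕ u *ℕ (e *ℕ v) ≟ m ⟧ μ e
      ≈⟨ sumTo-cong N (λ e 1≤e _ → multiples e 1≤e) ⟨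
    ∑[ e ≤ N ] ∑[ u ≤ N ] ∑[ v ≤ N ] ⟦ e ∣? u ⟧ ⟦ e ∣? v ⟧ ⟦ u *ℕ v ≟ m ⟧ μ e
      ≈⟨ sumTo-rotate N _ ⟨
    ∑[ u ≤ N ] ∑[ v ≤ N ] ∑[ e ≤ N ] ⟦ e ∣? u ⟧ ⟦ e ∣? v ⟧ ⟦ u *ℕ v ≟ m ⟧ μ e
      ≈⟨ sumTo-cong N (λ u 1≤u u≤N → sumTo-cong N (λ v _ _ → coprimePairs-μ N 1≤u u≤N)) ⟩
    coprimePairs N m ∎
    where
    regroup : ∀ e u v → e *ℕ e *ℕ (u *ℕ v) ≡ e *ℕ u *ℕ (e *ℕ v)
    regroup = solve-∀
    multiples : ∀ e → 1 ≤ e →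
      ∑[ u ≤ N ] ∑[ v ≤ N ] ⟦ e ∣? u ⟧ ⟦ e ∣? v ⟧ ⟦ u *ℕ v ≟ m ⟧ μ e ≈ ∑[ u ≤ N ] ∑[ v ≤ N ] ⟦ e *ℕ u *ℕ (e *ℕ v) ≟ m ⟧ μ e
    multiples e 1≤e = begin
      ∑[ u ≤ N ] ∑[ v ≤ N ] ⟦ e ∣? u ⟧ ⟦ e ∣? v ⟧ ⟦ u *ℕ v ≟ m ⟧ μ e
        ≈⟨ sumTo-cong N (λ u _ _ → ⟦⟧-sumTo N (e ∣? u) _) ⟨
      ∑[ u ≤ N ] ⟦ e ∣? u ⟧ ∑[ v ≤ N ] ⟦ e ∣? v ⟧ ⟦ u *ℕ v ≟ m ⟧ μ e
        ≈⟨ sumTo-∣-reindex N e _ 1≤e (λ u N<u → sumTo-zero N (λ v 1≤v _ → trans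
             (⟦⟧-cong (e ∣? v) (λ _ → ⟦⟧-no (u *ℕ v ≟ m) (λ uv≡m → ℕ.<⇒≱ N<u (factor-≤ˡ 1≤v uv≡m m≤N))))
             (⟦⟧-0 (e ∣? v)))) ⟩
      ∑[ u ≤ N ] ∑[ v ≤ N ] ⟦ e ∣? v ⟧ ⟦ e *ℕ u *ℕ v ≟ m ⟧ μ e
        ≈⟨ sumTo-cong N (λ u 1≤u _ → sumTo-∣-reindex N e _ 1≤e (λ v N<v → ⟦⟧-no (e *ℕ u *ℕ v ≟ m) (λ euv≡m →
             ℕ.<⇒≱ N<v (factor-≤ʳ (*-pos 1≤e 1≤u) euv≡m m≤N)))) ⟩
      ∑[ u ≤ N ] ∑[ v ≤ N ] ⟦ e *ℕ u *ℕ (e *ℕ v) ≟ m ⟧ μ e ∎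

  sum2-cong : ∀ n {g h} → (∀ a b → 1 ≤ a → 1 ≤ b → a *ℕ b ≡ n → g a b ≈ h a b) → sum2 n g ≈ sum2 n h
  sum2-cong n g≈h = trans (sum2-sumTo n _) (trans
    (sumTo-cong n (λ a 1≤a _ → sumTo-cong n (λ b 1≤b _ → ⟦⟧-cong (a *ℕ b ≟ n) (g≈h a b 1≤a 1≤b))))
    (sym (sum2-sumTo n _)))

  sumSq-cong : ∀ n {g h} → (∀ a c → 1 ≤ a → 1 ≤ c → a ≤ n → c ≤ n → a *ℕ a *ℕ c ≡ n → g a c ≈ h a c) → sumSq n g ≈ sumSq n h
  sumSq-cong n g≈h = trans (sumSq-sumTo n _) (trans
    (sumTo-cong n (λ a 1≤a a≤n → sumTo-cong n (λ c 1≤c c≤n → ⟦⟧-cong (a *ℕ a *ℕ c ≟ n) (g≈h a c 1≤a 1≤c a≤n c≤n))))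
    (sym (sumSq-sumTo n _)))

  sum3≈sumSq-coprimePairs : ∀ n (F : ℕ → Carrier) →
    sum3 n (λ a b c → F a * (μ b * nat (τ c))) ≈ sumSq n (λ a m → F a * coprimePairs n m)
  sum3≈sumSq-coprimePairs n F = begin
    sum3 n (λ a b c → F a * (μ b * nat (τ c)))
      ≈⟨ sum3-sumTo n _ ⟩
    ∑[ a ≤ n ] ∑[ b ≤ n ] ∑[ c ≤ n ] ⟦ a *ℕ a *ℕ b *ℕ b *ℕ c ≟ n ⟧ F a * (μ b * nat (τ c))
      ≈⟨ sumTo-cong n (λ a 1≤a _ → trans
           (sumTo-cong n (λ b _ _ → sumTo-cong n (λ c _ _ → ⟦≟⟧-cong n (regroup a b c))))
           (sumTo²-fibres n (a *ℕ a *ℕ_) (λ b c → b *ℕ b *ℕ c) (λ b c → F a * (μ b * nat (τ c))) ℕ.≤-refl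
              (λ m → m≤n*m⁺ m (*-pos 1≤a 1≤a)) (λ b c 1≤b 1≤c → *-pos (*-pos 1≤b 1≤b) 1≤c))) ⟩
    ∑[ a ≤ n ] ∑[ m ≤ n ] ⟦ a *ℕ a *ℕ m ≟ n ⟧ ∑[ b ≤ n ] ∑[ c ≤ n ] ⟦ b *ℕ b *ℕ c ≟ m ⟧ F a * (μ b * nat (τ c))
      ≈⟨ sumTo-cong n (λ a _ _ → sumTo-cong n (λ m _ m≤n → ⟦⟧-cong (a *ℕ a *ℕ m ≟ n) (λ _ →
           trans (sym (*-sumTo²-fibre n (F a) m (λ b c → b *ℕ b *ℕ c) _)) (*-congˡ (sumTo-μτ≈coprimePairs n m≤n))))) ⟩
    ∑[ a ≤ n ] ∑[ m ≤ n ] ⟦ a *ℕ a *ℕ m ≟ n ⟧ F a * coprimePairs n m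
      ≈⟨ sumSq-sumTo n _ ⟨
    sumSq n (λ a m → F a * coprimePairs n m) ∎
    where
    regroup : ∀ a b c → a *ℕ a *ℕ b *ℕ b *ℕ c ≡ a *ℕ a *ℕ (b *ℕ b *ℕ c)
    regroup = solve-∀

  sumSq-coprimePairs≈2^ω : ∀ n (F : ℕ → Carrier) →
    sumSq n (λ a m → F a * coprimePairs n m) ≈ sumSq n (λ a c → F a * nat (2 ^ ω c))
  sumSq-coprimePairs≈2^ω n F = sumSq-cong n (λ _ _ _ 1≤c _ c≤n _ → *-congˡ (coprimePairs≈2^ω n 1≤c c≤n))

  -- Each pair (x , y) is (d u , d v) for exactly one d and coprime u, v, namely d = gcd x y.
  gcd-representation : ∀ N {x y} (F : ℕ → Carrier) → 1 ≤ x → x ≤ N → 1 ≤ y → y ≤ N →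
    F (gcd x y) ≈ ∑[ d ≤ N ] ∑[ u ≤ N ] ∑[ v ≤ N ] ⟦ x ≟ d *ℕ u ⟧ ⟦ y ≟ d *ℕ v ⟧ ⟦ coprime? u v ⟧ F d
  gcd-representation N {x} {y} F 1≤x x≤N 1≤y y≤N with gcd[m,n]∣m x y | gcd[m,n]∣n x y
  ... | divides qx x≡qx*g | divides qy y≡qy*g = sym
    (trans (sumTo-single N g 1≤g (ℕ.≤-trans (∣⇒≤⁺ 1≤x (gcd[m,n]∣m x y)) x≤N) other-d)
    (trans (sumTo-single N qx 1≤qx (factor-≤ˡ 1≤g (≡.sym x≡qx*g) x≤N) other-u)
    (trans (sumTo-single N qy 1≤qy (factor-≤ˡ 1≤g (≡.sym y≡qy*g) y≤N) other-v)
    (trans (⟦⟧-yes (x ≟ g *ℕ qx) x≡g*qx) (trans (⟦⟧-yes (y ≟ g *ℕ qy) y≡g*qy)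
           (⟦⟧-yes (coprime? qx qy) (gcd-cofactors-coprime 1≤x x≡qx*g y≡qy*g)))))))
    where
    g = gcd x y
    1≤g = gcd-pos x y 1≤x
    x≡g*qx = ≡.trans x≡qx*g (ℕ.*-comm qx g)
    y≡g*qy = ≡.trans y≡qy*g (ℕ.*-comm qy g)
    1≤qx = ≡*⇒pos qx 1≤x x≡qx*g
    1≤qy = ≡*⇒pos qy 1≤y y≡qy*g
    other-d : ∀ d → 1 ≤ d → d ≤ N → d ≢ g →
              ∑[ u ≤ N ] ∑[ v ≤ N ] ⟦ x ≟ d *ℕ u ⟧ ⟦ y ≟ d *ℕ v ⟧ ⟦ coprime? u v ⟧ F d ≈ 0#
    other-d d _ _ d≢g = sumTo-zero N λ u _ _ → sumTo-zero N λ v _ _ →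
      ⟦⟧-no₃ (x ≟ d *ℕ u) (y ≟ d *ℕ v) (coprime? u v)
        (λ x≡du y≡dv u⊥v → d≢g (≡.sym (≡.trans (≡.cong₂ gcd x≡du y≡dv) (gcd-*-coprime-cofactors d u⊥v))))
    other-u : ∀ u → 1 ≤ u → u ≤ N → u ≢ qx → ∑[ v ≤ N ] ⟦ x ≟ g *ℕ u ⟧ ⟦ y ≟ g *ℕ v ⟧ ⟦ coprime? u v ⟧ F g ≈ 0#
    other-u u _ _ u≢qx = sumTo-zero N λ v _ _ → ⟦⟧-no₃ (x ≟ g *ℕ u) (y ≟ g *ℕ v) (coprime? u v)
      (λ x≡gu _ _ → u≢qx (*-cancelˡ-≡⁺ u qx 1≤g (≡.trans (≡.sym x≡gu) x≡g*qx)))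
    other-v : ∀ v → 1 ≤ v → v ≤ N → v ≢ qy → ⟦ x ≟ g *ℕ qx ⟧ ⟦ y ≟ g *ℕ v ⟧ ⟦ coprime? qx v ⟧ F g ≈ 0#
    other-v v _ _ v≢qy = ⟦⟧-no₃ (x ≟ g *ℕ qx) (y ≟ g *ℕ v) (coprime? qx v)
      (λ _ y≡gv _ → v≢qy (*-cancelˡ-≡⁺ v qy 1≤g (≡.trans (≡.sym y≡gv) y≡g*qy)))

  G≈sumSq-coprimePairs : ∀ n f → G f n ≈ sumSq n (λ d m → f d * coprimePairs n m)
  G≈sumSq-coprimePairs n f = begin
    G f n
      ≈⟨ sum2-sumTo n _ ⟩
    ∑[ x ≤ n ] ∑[ y ≤ n ] ⟦ x *ℕ y ≟ n ⟧ f (gcd x y)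
      ≈⟨ sumTo-cong n (λ x 1≤x x≤n → sumTo-cong n (λ y 1≤y y≤n → gcd-representation n (λ d → ⟦ x *ℕ y ≟ n ⟧ f d) 1≤x x≤n 1≤y y≤n)) ⟩
    ∑[ x ≤ n ] ∑[ y ≤ n ] ∑[ d ≤ n ] ∑[ u ≤ n ] ∑[ v ≤ n ] T x y d u v
      ≈⟨ trans (sumTo-rotate n _) (sumTo-cong n (λ d _ _ → trans (sumTo-rotate n _) (sumTo-cong n (λ u _ _ → sumTo-rotate n _)))) ⟩
    ∑[ d ≤ n ] ∑[ u ≤ n ] ∑[ v ≤ n ] ∑[ x ≤ n ] ∑[ y ≤ n ] T x y d u v
      ≈⟨ sumTo-cong n (λ d 1≤d _ → sumTo-cong n (λ u 1≤u _ → sumTo-cong n (λ v 1≤v _ → collapse d u v 1≤d 1≤u 1≤v))) ⟩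
    ∑[ d ≤ n ] ∑[ u ≤ n ] ∑[ v ≤ n ] ⟦ d *ℕ d *ℕ (u *ℕ v) ≟ n ⟧ ⟦ coprime? u v ⟧ f d
      ≈⟨ sumTo-cong n (λ d 1≤d _ → sumTo²-fibres n (d *ℕ d *ℕ_) _*ℕ_ (λ u v → ⟦ coprime? u v ⟧ f d) ℕ.≤-refl
           (λ m → m≤n*m⁺ m (*-pos 1≤d 1≤d)) (λ _ _ → *-pos)) ⟩
    ∑[ d ≤ n ] ∑[ m ≤ n ] ⟦ d *ℕ d *ℕ m ≟ n ⟧ ∑[ u ≤ n ] ∑[ v ≤ n ] ⟦ u *ℕ v ≟ m ⟧ ⟦ coprime? u v ⟧ f d
      ≈⟨ sumTo-cong n (λ d _ _ → sumTo-cong n (λ m _ _ → ⟦⟧-cong (d *ℕ d *ℕ m ≟ n) (λ _ → factor d m))) ⟩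
    ∑[ d ≤ n ] ∑[ m ≤ n ] ⟦ d *ℕ d *ℕ m ≟ n ⟧ f d * coprimePairs n m
      ≈⟨ sumSq-sumTo n _ ⟨
    sumSq n (λ d m → f d * coprimePairs n m) ∎
    where
    T : ℕ → ℕ → ℕ → ℕ → ℕ → Carrier
    T x y d u v = ⟦ x ≟ d *ℕ u ⟧ ⟦ y ≟ d *ℕ v ⟧ ⟦ coprime? u v ⟧ ⟦ x *ℕ y ≟ n ⟧ f d
    regroup : ∀ d u v → d *ℕ u *ℕ (d *ℕ v) ≡ d *ℕ d *ℕ (u *ℕ v)
    regroup = solve-∀
    collapse : ∀ d u v → 1 ≤ d → 1 ≤ u → 1 ≤ v →
      ∑[ x ≤ n ] ∑[ y ≤ n ] T x y d u v ≈ ⟦ d *ℕ d *ℕ (u *ℕ v) ≟ n ⟧ ⟦ coprime? u v ⟧ f d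
    collapse d u v 1≤d 1≤u 1≤v = trans
      (sumTo²-≟ n (d *ℕ u) (d *ℕ v) (λ x y → ⟦ coprime? u v ⟧ ⟦ x *ℕ y ≟ n ⟧ f d) (*-pos 1≤d 1≤u) (*-pos 1≤d 1≤v)
        λ too-big → trans (⟦⟧-cong (coprime? u v) (λ _ → ⟦⟧-no (d *ℕ u *ℕ (d *ℕ v) ≟ n) λ du*dv≡n →
          [ (λ n<du → ℕ.<⇒≱ n<du (factor-≤ˡ (*-pos 1≤d 1≤v) du*dv≡n ℕ.≤-refl))
          , (λ n<dv → ℕ.<⇒≱ n<dv (factor-≤ʳ (*-pos 1≤d 1≤u) du*dv≡n ℕ.≤-refl)) ] too-big))
          (⟦⟧-0 (coprime? u v)))
      (trans (⟦⟧-swap (coprime? u v) (d *ℕ u *ℕ (d *ℕ v) ≟ n)) (⟦≟⟧-cong n (regroup d u v)))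
    factor : ∀ d m → ∑[ u ≤ n ] ∑[ v ≤ n ] ⟦ u *ℕ v ≟ m ⟧ ⟦ coprime? u v ⟧ f d ≈ f d * coprimePairs n m
    factor d m = sym (trans (*-sumToˡ n (f d) _) (sumTo-cong n (λ u _ _ → trans (*-sumToˡ n (f d) _) (sumTo-cong n (λ v _ _ →
      trans (⟦⟧-*ˡ (coprimeFactors? m u v)) (trans (⟦⟧-cong (coprimeFactors? m u v) (λ _ → *-identityʳ (f d)))
            (sym (⟦⟧-nest (u *ℕ v ≟ m) (coprime? u v)))))))))

  conv-sumTo² : ∀ N g h {e} → 1 ≤ e → e ≤ N → conv g h e ≈ ∑[ a ≤ N ] ∑[ b ≤ N ] ⟦ a *ℕ b ≟ e ⟧ g a * h b
  conv-sumTo² N g h {e} 1≤e e≤N = begin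
    conv g h e                                    ≈⟨ conv-sumTo g h e ⟩
    ∑[ a ≤ e ] ⟦ a ∣? e ⟧ g a * h (e div a)       ≈⟨ sumTo-extend e N e≤N (λ a e<a _ → ⟦⟧-no (a ∣? e) (λ a∣e → ℕ.<⇒≱ e<a (∣⇒≤⁺ 1≤e a∣e))) ⟨
    ∑[ a ≤ N ] ⟦ a ∣? e ⟧ g a * h (e div a)       ≈⟨ sumTo-cong N (λ a 1≤a _ → sumTo-*≟ N a e (λ b → g a * h b) 1≤a 1≤e e≤N) ⟨
    ∑[ a ≤ N ] ∑[ b ≤ N ] ⟦ a *ℕ b ≟ e ⟧ g a * h b ∎

  sum3≈sumSq-conv : ∀ n f → sum3 n (λ a b c → f a * (μ b * nat (τ c))) ≈ sumSq n (λ e c → conv f μ e * nat (τ c))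
  sum3≈sumSq-conv n f = begin
    sum3 n (λ a b c → f a * (μ b * nat (τ c)))
      ≈⟨ sum3-sumTo n _ ⟩
    ∑[ a ≤ n ] ∑[ b ≤ n ] ∑[ c ≤ n ] ⟦ a *ℕ a *ℕ b *ℕ b *ℕ c ≟ n ⟧ f a * (μ b * nat (τ c))
      ≈⟨ trans (sumTo-rotate n _) (sumTo-cong n (λ c _ _ → sumTo-cong n (λ a _ _ → sumTo-cong n (λ b _ _ →
           trans (⟦≟⟧-cong n (regroup a b c)) (⟦⟧-cong (a *ℕ b *ℕ (a *ℕ b) *ℕ c ≟ n) (λ _ → sym (*-assoc _ _ _))))))) ⟩
    ∑[ c ≤ n ] ∑[ a ≤ n ] ∑[ b ≤ n ] ⟦ a *ℕ b *ℕ (a *ℕ b) *ℕ c ≟ n ⟧ f a * μ b * nat (τ c)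
      ≈⟨ sumTo-cong n (λ c 1≤c _ → sumTo²-fibres n (λ e → e *ℕ e *ℕ c) _*ℕ_ (λ a b → f a * μ b * nat (τ c)) ℕ.≤-refl
           (λ e → m≤m*m*n⁺ e 1≤c) (λ _ _ → *-pos)) ⟩
    ∑[ c ≤ n ] ∑[ e ≤ n ] ⟦ e *ℕ e *ℕ c ≟ n ⟧ ∑[ a ≤ n ] ∑[ b ≤ n ] ⟦ a *ℕ b ≟ e ⟧ f a * μ b * nat (τ c)
      ≈⟨ sumTo-cong n (λ c _ _ → sumTo-cong n (λ e 1≤e e≤n → ⟦⟧-cong (e *ℕ e *ℕ c ≟ n) (λ _ → begin
           ∑[ a ≤ n ] ∑[ b ≤ n ] ⟦ a *ℕ b ≟ e ⟧ f a * μ b * nat (τ c)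
             ≈⟨ sumTo-cong n (λ a _ _ → sumTo-cong n (λ b _ _ → ⟦⟧-*ʳ (a *ℕ b ≟ e))) ⟨
           ∑[ a ≤ n ] ∑[ b ≤ n ] (⟦ a *ℕ b ≟ e ⟧ f a * μ b) * nat (τ c)
             ≈⟨ trans (*-sumToʳ n _ _) (sumTo-cong n (λ a _ _ → *-sumToʳ n _ _)) ⟨
           (∑[ a ≤ n ] ∑[ b ≤ n ] ⟦ a *ℕ b ≟ e ⟧ f a * μ b) * nat (τ c)
             ≈⟨ *-congʳ (conv-sumTo² n f μ 1≤e e≤n) ⟨
           conv f μ e * nat (τ c) ∎))) ⟩
    ∑[ c ≤ n ] ∑[ e ≤ n ] ⟦ e *ℕ e *ℕ c ≟ n ⟧ conv f μ e * nat (τ c)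
      ≈⟨ sumTo-comm n n _ ⟩
    ∑[ e ≤ n ] ∑[ c ≤ n ] ⟦ e *ℕ e *ℕ c ≟ n ⟧ conv f μ e * nat (τ c)
      ≈⟨ sumSq-sumTo n _ ⟨
    sumSq n (λ e c → conv f μ e * nat (τ c)) ∎
    where
    regroup : ∀ a b c → a *ℕ a *ℕ b *ℕ b *ℕ c ≡ a *ℕ b *ℕ (a *ℕ b) *ℕ c
    regroup = solve-∀

  G≈sum3-μτ : ∀ n f → G f n ≈ sum3 n (λ a b c → f a * (μ b * nat (τ c)))
  G≈sum3-μτ n f = trans (G≈sumSq-coprimePairs n f) (sym (sum3≈sumSq-coprimePairs n f))

  sum3-μτ≈sumSq-2^ω : ∀ n F → sum3 n (λ a b c → F a * (μ b * nat (τ c))) ≈ sumSq n (λ a c → F a * nat (2 ^ ω c))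
  sum3-μτ≈sumSq-2^ω n F = trans (sum3≈sumSq-coprimePairs n F) (sumSq-coprimePairs≈2^ω n F)

  L≈G-div : ∀ n f → L f n ≈ G (λ d → f (n div d)) n
  L≈G-div n f = sum2-cong n (λ a b 1≤a _ ab≡n → reflexive (≡.cong f (lcm≡div-gcd 1≤a ab≡n)))

  -- Additive functions

  module _ (f : ℕ → Carrier) where

    LcmGcdSum : ℕ → ℕ → Set ℓ
    LcmGcdSum x y = f (lcm x y) + f (gcd x y) ≈ f x + f y

    lcmGcdSum-comm : ∀ {x y} → LcmGcdSum y x → LcmGcdSum x y
    lcmGcdSum-comm {x} {y} h = begin
      f (lcm x y) + f (gcd x y) ≡⟨ ≡.cong₂ (λ l g → f l + f g) (lcm-comm x y) (gcd-comm x y) ⟩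
      f (lcm y x) + f (gcd y x) ≈⟨ h ⟩
      f y + f x                 ≈⟨ +-comm (f y) (f x) ⟩
      f x + f y                 ∎

    module _ (additive : Additive f) where

      additive-p-adic : ∀ {p m} k → Prime p → 1 ≤ m → ¬ p ∣ m → f (p ^ k *ℕ m) ≈ f (p ^ k) + f m
      additive-p-adic k pp 1≤m p∤m = additive _ _ (^-pos k (prime-pos pp)) 1≤m (^-coprime pp p∤m k)

      lcmGcdSum-p-adic : ∀ {p a b x y} → Prime p → a ≤ b → 1 ≤ x → 1 ≤ y → ¬ p ∣ x → ¬ p ∣ y →
                         LcmGcdSum x y → LcmGcdSum (p ^ a *ℕ x) (p ^ b *ℕ y)
      lcmGcdSum-p-adic {p} {a} {b} {x} {y} pp a≤b 1≤x 1≤y p∤x p∤y hyp = begin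
        f (lcm (p ^ a *ℕ x) (p ^ b *ℕ y)) + f (gcd (p ^ a *ℕ x) (p ^ b *ℕ y))
          ≡⟨ ≡.cong₂ (λ l g → f l + f g) (proj₂ p-adic) (proj₁ p-adic) ⟩
        f (p ^ b *ℕ lcm x y) + f (p ^ a *ℕ gcd x y)
          ≈⟨ +-cong (additive-p-adic b pp (lcm-pos x y 1≤x 1≤y) p∤lcm) (additive-p-adic a pp (gcd-pos x y 1≤x) p∤gcd) ⟩
        (f (p ^ b) + f (lcm x y)) + (f (p ^ a) + f (gcd x y))
          ≈⟨ interchange _ _ _ _ ⟩
        (f (p ^ b) + f (p ^ a)) + (f (lcm x y) + f (gcd x y))
          ≈⟨ +-cong (+-comm _ _) hyp ⟩
        (f (p ^ a) + f (p ^ b)) + (f x + f y)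
          ≈⟨ interchange _ _ _ _ ⟩
        (f (p ^ a) + f x) + (f (p ^ b) + f y)
          ≈⟨ +-cong (additive-p-adic a pp 1≤x p∤x) (additive-p-adic b pp 1≤y p∤y) ⟨
        f (p ^ a *ℕ x) + f (p ^ b *ℕ y) ∎
        where
        p-adic = gcd-lcm-p-adic {b = b} {y = y} pp a≤b 1≤x p∤x
        p∤gcd : ¬ p ∣ gcd x y
        p∤gcd p∣g = p∤x (∣-trans p∣g (gcd[m,n]∣m x y))
        p∤lcm : ¬ p ∣ lcm x y
        p∤lcm p∣l = [ p∤x , p∤y ] (euclidsLemma x y pp (≡.subst (p ∣_) (gcd*lcm x y) (∣n⇒∣m*n (gcd x y) p∣l)))

      -- Induction on x, splitting off the full power of one prime p ∣ x from both arguments.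
      additive-lcm-gcd : ∀ {x y} → 1 ≤ x → 1 ≤ y → LcmGcdSum x y
      additive-lcm-gcd {x} = <-rec (λ x → ∀ {y} → 1 ≤ x → 1 ≤ y → LcmGcdSum x y) step x
        where
        step : ∀ x → (∀ {x′} → x′ < x → ∀ {y} → 1 ≤ x′ → 1 ≤ y → LcmGcdSum x′ y) → ∀ {y} → 1 ≤ x → 1 ≤ y → LcmGcdSum x y
        step (suc zero) _ {y} _ _ = begin
          f (lcm 1 y) + f (gcd 1 y) ≡⟨ ≡.cong₂ (λ l g → f l + f g) (lcm-unique 1 y y (s≤s z≤n) (≡.cong (_*ℕ y) (gcd-zeroˡ y))) (gcd-zeroˡ y) ⟩
          f y + f 1                 ≈⟨ +-comm (f y) (f 1) ⟩
          f 1 + f y                 ∎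
        step x@(suc (suc _)) rec {y} 1≤x 1≤y with prime-divisor x (s≤s (s≤s z≤n))
        ... | p , pp , p∣x with p-adic-split pp 1≤x | p-adic-split pp 1≤y
        ... | a , x′ , x≡ , p∤x′ | b , y′ , y≡ , p∤y′ = ≡.subst₂ LcmGcdSum (≡.sym x≡) (≡.sym y≡) (by-cases (a ≤? b))
          where
          1≤x′ = ≡*⇒pos x′ 1≤x (≡.trans x≡ (ℕ.*-comm (p ^ a) x′))
          1≤y′ = ≡*⇒pos y′ 1≤y (≡.trans y≡ (ℕ.*-comm (p ^ b) y′))
          IH : LcmGcdSum x′ y′
          IH = rec (p-adic-cofactor-< {a = a} pp p∣x 1≤x x≡ p∤x′) 1≤x′ 1≤y′
          by-cases : Dec (a ≤ b) → LcmGcdSum (p ^ a *ℕ x′) (p ^ b *ℕ y′)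
          by-cases (yes a≤b) = lcmGcdSum-p-adic pp a≤b 1≤x′ 1≤y′ p∤x′ p∤y′ IH
          by-cases (no  a≰b) = lcmGcdSum-comm (lcmGcdSum-p-adic pp (ℕ.<⇒≤ (ℕ.≰⇒> a≰b)) 1≤y′ 1≤x′ p∤y′ p∤x′ (lcmGcdSum-comm IH))

  sum2-+ : ∀ n g h → sum2 n g + sum2 n h ≈ sum2 n (λ a b → g a b + h a b)
  sum2-+ n g h = begin
    sum2 n g + sum2 n h
      ≈⟨ +-cong (sum2-sumTo n g) (sum2-sumTo n h) ⟩
    (∑[ a ≤ n ] ∑[ b ≤ n ] ⟦ a *ℕ b ≟ n ⟧ g a b) + (∑[ a ≤ n ] ∑[ b ≤ n ] ⟦ a *ℕ b ≟ n ⟧ h a b)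
      ≈⟨ trans (sumTo-cong n (λ a _ _ → trans (sumTo-cong n (λ b _ _ → ⟦⟧-+ (a *ℕ b ≟ n))) (sumTo-+ n _ _))) (sumTo-+ n _ _) ⟨
    ∑[ a ≤ n ] ∑[ b ≤ n ] ⟦ a *ℕ b ≟ n ⟧ (g a b + h a b)
      ≈⟨ sum2-sumTo n _ ⟨
    sum2 n (λ a b → g a b + h a b) ∎

  L+G : ∀ n f h → (∀ x y → 1 ≤ x → 1 ≤ y → x *ℕ y ≡ n → f (lcm x y) + f (gcd x y) ≈ h x y) → L f n + G f n ≈ sum2 n h
  L+G n f h pointwise = trans (sum2-+ n _ _) (sum2-cong n pointwise)

  sum2-divisors : ∀ n g → 1 ≤ n → sum2 n (λ a _ → g a) ≈ conv g 𝟙 n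
  sum2-divisors n g 1≤n = begin
    sum2 n (λ a _ → g a)                       ≈⟨ sum2-sumTo n _ ⟩
    ∑[ a ≤ n ] ∑[ b ≤ n ] ⟦ a *ℕ b ≟ n ⟧ g a    ≈⟨ sumTo-cong n (λ a 1≤a _ → sumTo-*≟ n a n (λ _ → g a) 1≤a 1≤n ℕ.≤-refl) ⟩
    ∑[ a ≤ n ] ⟦ a ∣? n ⟧ g a                  ≈⟨ sumTo-cong n (λ a _ _ → ⟦⟧-cong (a ∣? n) (λ _ → *-identityʳ (g a))) ⟨
    ∑[ a ≤ n ] ⟦ a ∣? n ⟧ g a * 1#             ≈⟨ conv-sumTo g 𝟙 n ⟨
    conv g 𝟙 n                                 ∎

  sum2-comm : ∀ n g → sum2 n g ≈ sum2 n (λ a b → g b a)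
  sum2-comm n g = begin
    sum2 n g                                       ≈⟨ sum2-sumTo n g ⟩
    ∑[ a ≤ n ] ∑[ b ≤ n ] ⟦ a *ℕ b ≟ n ⟧ g a b      ≈⟨ sumTo-comm n n _ ⟩
    ∑[ b ≤ n ] ∑[ a ≤ n ] ⟦ a *ℕ b ≟ n ⟧ g a b      ≈⟨ sumTo-cong n (λ b _ _ → sumTo-cong n (λ a _ _ → ⟦≟⟧-cong n (ℕ.*-comm a b))) ⟩
    ∑[ b ≤ n ] ∑[ a ≤ n ] ⟦ b *ℕ a ≟ n ⟧ g a b      ≈⟨ sum2-sumTo n _ ⟨
    sum2 n (λ a b → g b a)                         ∎

  sum2-const : ∀ n x → 1 ≤ n → sum2 n (λ _ _ → x) ≈ τ n · x
  sum2-const n x 1≤n = begin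
    sum2 n (λ _ _ → x)                                 ≈⟨ sum2-sumTo n _ ⟩
    ∑[ a ≤ n ] ∑[ b ≤ n ] ⟦ a *ℕ b ≟ n ⟧ x              ≈⟨ sumTo-cong n (λ a _ _ → sumTo-cong n (λ b _ _ →
                                                            trans (⟦⟧-*ʳ (a *ℕ b ≟ n)) (⟦⟧-cong (a *ℕ b ≟ n) (λ _ → *-identityˡ x)))) ⟨
    ∑[ a ≤ n ] ∑[ b ≤ n ] (⟦ a *ℕ b ≟ n ⟧ 1#) * x       ≈⟨ trans (*-sumToʳ n x _) (sumTo-cong n (λ a _ _ → *-sumToʳ n x _)) ⟨
    (∑[ a ≤ n ] ∑[ b ≤ n ] ⟦ a *ℕ b ≟ n ⟧ 1#) * x       ≈⟨ *-congʳ (τ-sumTo n 1≤n ℕ.≤-refl) ⟨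
    nat (τ n) * x                                      ≈⟨ ·≈nat* (τ n) x ⟨
    τ n · x                                            ∎

  L≈2·divisorSum-G : ∀ n f → Additive f → 1 ≤ n → L f n ≈ (2 · conv f 𝟙 n) - G f n
  L≈2·divisorSum-G n f additive 1≤n = x≈z//y _ _ _ (begin
    L f n + G f n                                   ≈⟨ L+G n f _ (λ x y 1≤x 1≤y _ → additive-lcm-gcd f additive 1≤x 1≤y) ⟩
    sum2 n (λ x y → f x + f y)                      ≈⟨ sum2-+ n _ _ ⟨
    sum2 n (λ x _ → f x) + sum2 n (λ _ y → f y)     ≈⟨ +-congˡ (sum2-comm n _) ⟨
    sum2 n (λ x _ → f x) + sum2 n (λ x _ → f x)     ≈⟨ +-cong (sum2-divisors n f 1≤n) (trans (sum2-divisors n f 1≤n) (sym (+-identityʳ _))) ⟩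
    2 · conv f 𝟙 n                                  ∎)

  L≈τ·f-G : ∀ n f → CompletelyAdditive f → 1 ≤ n → L f n ≈ (τ n · f n) - G f n
  L≈τ·f-G n f completelyAdditive 1≤n = x≈z//y _ _ _ (begin
    L f n + G f n        ≈⟨ L+G n f _ lcm*gcd ⟩
    sum2 n (λ _ _ → f n) ≈⟨ sum2-const n (f n) 1≤n ⟩
    τ n · f n            ∎)
    where
    lcm*gcd : ∀ x y → 1 ≤ x → 1 ≤ y → x *ℕ y ≡ n → f (lcm x y) + f (gcd x y) ≈ f n
    lcm*gcd x y 1≤x 1≤y xy≡n = trans (sym (completelyAdditive _ _ (lcm-pos x y 1≤x 1≤y) (gcd-pos x y 1≤x)))
      (reflexive (≡.cong f (≡.trans (ℕ.*-comm (lcm x y) (gcd x y)) (≡.trans (gcd*lcm x y) xy≡n))))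

proposition1 : ∀ {c ℓ : Level} (R : CommutativeRing c ℓ) → let open Arith R in
    (f : ℕ → Carrier) →
    (∀ n → 1 ≤ n →
        (G f n ≈ sum3 n (λ a b c → f a * (μ b * nat (τ c))))
      × (sum3 n (λ a b c → f a * (μ b * nat (τ c))) ≈ sumSq n (λ a c → conv f μ a * nat (τ c)))
      × (sumSq n (λ a c → conv f μ a * nat (τ c)) ≈ sumSq n (λ a c → f a * nat (2 ^ ω c)))
      × (L f n ≈ sum3 n (λ a b c → f (n div a) * (μ b * nat (τ c))))
      × (sum3 n (λ a b c → f (n div a) * (μ b * nat (τ c))) ≈ sumSq n (λ a c → f (a *ℕ c) * nat (2 ^ ω c))))
    × (Additive f → ∀ n → 1 ≤ n → L f n ≈ (2 · conv f 𝟙 n) - G f n)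
    × (CompletelyAdditive f → ∀ n → 1 ≤ n → L f n ≈ (τ n · f n) - G f n)
proposition1 R f =
    (λ n _ → G≈sum3-μτ R n f
           , sum3≈sumSq-conv R n f
           , trans (sym (sum3≈sumSq-conv R n f)) (sum3-μτ≈sumSq-2^ω R n f)
           , trans (L≈G-div R n f) (G≈sum3-μτ R n (λ d → f (n div d)))
           , trans (sum3-μτ≈sumSq-2^ω R n (λ d → f (n div d)))
                   (sumSq-cong R n (λ a c 1≤a _ _ _ aac≡n → *-congʳ (reflexive (≡.cong f (div-square 1≤a aac≡n))))))
  , (λ additive n 1≤n → L≈2·divisorSum-G R n f additive 1≤n)
  , (λ completelyAdditive n 1≤n → L≈τ·f-G R n f completelyAdditive 1≤n)
  where open Arith R
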